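{- Let $w\in S_n$, $D\in RP(w)$ and $1\le i<n$. Then $f_i(D)=0$ if and only if $f_i(\phi(D))=0$.
   Context: Index the boxes of the $n\times n$ grid by $(i,j)$, row $i$ from the top, column $j$ from the left. Pipe dreams. A pipe dream is a covering of each box by a cross tile or an elbow tile, where crosses are only allowed in boxes with $i+j\le n$. Connecting tiles gives pipes that enter at the left of each row and exit at the top of a column: a cross lets one pipe pass horizontally and one vertically; an elbow joins the left edge to the top edge and the bottom edge to the right edge. $D$ is a pipe dream for $w$ if the pipe entering row $i$ exits from column $w(i)$. It is reduced if any two pipes cross at most once. $RP(w)$ is the set of reduced pipe dreams for $w$, and $D_+$ is the set of boxes carrying crosses. Pairing on pipe dreams (row $i$). The crosses of row $i$ are considered from right to left. The cross $(i,j)$ is paired with the leftmost not-yet-paired cross of row $i+1$ in a column $\ge j$, if one exists; otherwise it is unpaired. $f_i$ on pipe dreams. If every cross of row $i$ is paired, set $f_i(D)=0$. Otherwise let $(i,j)$ be the leftmost unpaired cross of row $i$. If $(i,k)\in D_+$ for all $1\le k\le j$, set $f_i(D)=0$. Otherwise take $m\ge1$ with $(i,j-m),(i+1,j-m)\notin D_+$ and $(i,j-k),(i+1,j-k)\in D_+$ for $1\le k<m$, and set $f_i(D)_+=(D_+\setminus\{(i,j)\})\cup\{(i+1,j-m)\}$. Reduced factorizations with cutoff. For $v\in S_n$, $RFC(v)$ is the set of reduced words $a_1\cdots a_p$ of $v$ (meaning $v=s_{a_1}\cdots s_{a_p}$, $p=\ell(v)$) divided into $n-1$ consecutive, possibly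 empty, blocks $r=(r^{n-1})\cdots(r^1)$, numbered right to left, such that letters strictly increase in each block and the leftmost letter of each nonempty $r^i$ is $\ge i$. Pairing on factorizations (block $i$). The letters of $r^i$ are considered from largest to smallest. A letter $a$ is paired with the smallest not-yet-paired letter $b$ of $r^{i+1}$ with $a<b$, if one exists; otherwise $a$ is unpaired. $f_i$ on factorizations. If all letters of $r^i$ are paired, set $f_i(r)=0$. Otherwise let $u$ be the smallest unpaired letter of $r^i$ and $t=\max\{z\le u: z-1\notin r^i\}$. Let $f_i(r)$ be obtained by removing $u$ from $r^i$ and inserting $t$ into $r^{i+1}$, keeping blocks increasing. If this result is not in $RFC(v)$, set $f_i(r)=0$. $\phi:RP(w)\to RFC(w^{ -1})$ sends $D$ to the factorization whose block $r^k$ consists of the numbers $k+j-1$ for crosses $(k,j)\in D_+$ in row $k$, in increasing order. -}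

module Defs where

open import Data.Nat using (ℕ; zero; suc; _+_; _*_; _∸_; _≤_; _<_; _≤ᵇ_; _<ᵇ_; _≡ᵇ_; _⊓_)
open import Data.Bool using (Bool; true; false; if_then_else_; _∧_; _∨_; not)
open import Data.List using (List; []; _∷_; map; reverse; concat; length; upTo; downFrom; allFin)
open import Data.Nat.ListAction using (sum)
open import Data.List.Relation.Unary.All using (All)
open import Data.List.Relation.Unary.Linked using (Linked)
open import Data.Maybe using (Maybe; just; nothing)
open import Data.Product using (_×_; _,_; proj₁; proj₂)
open import Data.Sum using (_⊎_)
open import Data.Unit using (⊤)
open import Data.Fin using (Fin; toℕ)
open import Data.Fin.Permutation using (Permutation′; _⟨$⟩ʳ_)
open import Relation.Binary.PropositionalEquality using (_≡_)
open import Relation.Nullary using (¬_)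

-- Conventions: all indices are 1-based natural numbers, as in the paper.
-- Values of a permutation w ∈ S_n (stdlib Permutation′ n, on Fin n = {0..n-1})
-- are shifted by one: the paper's w(i) is  suc (toℕ (w ⟨$⟩ʳ (i-1))).

oneTo : ℕ → List ℕ
oneTo n = map suc (upTo n)

countB : {A : Set} → (A → Bool) → List A → ℕ
countB p [] = 0
countB p (x ∷ xs) = if p x then suc (countB p xs) else countB p xs

filterB : {A : Set} → (A → Bool) → List A → List A
filterB p [] = []
filterB p (x ∷ xs) = if p x then x ∷ filterB p xs else filterB p xs

anyB : {A : Set} → (A → Bool) → List A → Bool
anyB p [] = false
anyB p (x ∷ xs) = p x ∨ anyB p xs

memℕ : ℕ → List ℕ → Bool
memℕ x = anyB (x ≡ᵇ_)

minL : List ℕ → Maybe ℕ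
minL [] = nothing
minL (x ∷ xs) with minL xs
... | nothing = just x
... | just m  = just (x ⊓ m)

sᵢ : ℕ → ℕ → ℕ
sᵢ a y = if y ≡ᵇ a then suc a else (if y ≡ᵇ suc a then a else y)

-- action of the product s_{a_1} s_{a_2} ⋯ s_{a_p} (composition of functions,
-- so s_{a_p} is applied first)
actWord : List ℕ → ℕ → ℕ
actWord [] y = y
actWord (a ∷ as) y = sᵢ a (actWord as y)

invCount : {n : ℕ} → Permutation′ n → ℕ
invCount {n} v =
  sum (map (λ x → countB (λ y → (toℕ x <ᵇ toℕ y) ∧ (toℕ (v ⟨$⟩ʳ y) <ᵇ toℕ (v ⟨$⟩ʳ x)))
                         (allFin n))
           (allFin n))

IsReducedWord : (n : ℕ) → Permutation′ n → List ℕ → Set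
IsReducedWord n v ws =
  All (λ a → 1 ≤ a × suc a ≤ n) ws
  × length ws ≡ invCount v
  × (∀ (x : Fin n) → actWord ws (suc (toℕ x)) ≡ suc (toℕ (v ⟨$⟩ʳ x)))

-- D i j = true  iff  the box (i,j) carries a cross, i.e. (i,j) ∈ D_+
Grid : Set
Grid = ℕ → ℕ → Bool

IsPipeDream : ℕ → Grid → Set
IsPipeDream n D = ∀ i j → D i j ≡ true → 1 ≤ i × 1 ≤ j × i + j ≤ n

data Dir : Set where
  fromLeft fromBottom : Dir

-- follow a pipe entering box (r,c) through the given edge; returns the list
-- of boxes traversed and the column through whose top it exits (row 1).
-- The Maybe is only a fuel guard (nothing = fuel exhausted).
walk : Grid → ℕ → ℕ → ℕ → Dir → List (ℕ × ℕ) × Maybe ℕ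
walk D zero r c d = [] , nothing
walk D (suc f) r c fromLeft with D r c
... | true  = let p = walk D f r (suc c) fromLeft in ((r , c) ∷ proj₁ p) , proj₂ p
... | false = exitTop r
  where
  exitTop : ℕ → List (ℕ × ℕ) × Maybe ℕ
  exitTop zero = ((r , c) ∷ []) , nothing
  exitTop (suc zero) = ((r , c) ∷ []) , just c
  exitTop (suc (suc r')) = let p = walk D f (suc r') c fromBottom in ((r , c) ∷ proj₁ p) , proj₂ p
walk D (suc f) r c fromBottom with D r c
... | false = let p = walk D f r (suc c) fromLeft in ((r , c) ∷ proj₁ p) , proj₂ p
... | true  = exitTop r
  where
  exitTop : ℕ → List (ℕ × ℕ) × Maybe ℕ
  exitTop zero = ((r , c) ∷ []) , nothing
  exitTop (suc zero) = ((r , c) ∷ []) , just c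
  exitTop (suc (suc r')) = let p = walk D f (suc r') c fromBottom in ((r , c) ∷ proj₁ p) , proj₂ p

-- the pipe entering the left of row i (a pipe visits at most 2n boxes)
pipe : ℕ → Grid → ℕ → List (ℕ × ℕ) × Maybe ℕ
pipe n D i = walk D (2 * n + 2) i 1 fromLeft

pipeExit : ℕ → Grid → ℕ → Maybe ℕ
pipeExit n D i = proj₂ (pipe n D i)

IsPipeDreamFor : (n : ℕ) → Permutation′ n → Grid → Set
IsPipeDreamFor n w D =
  IsPipeDream n D
  × (∀ (x : Fin n) → pipeExit n D (suc (toℕ x)) ≡ just (suc (toℕ (w ⟨$⟩ʳ x))))

boxEq : ℕ × ℕ → ℕ × ℕ → Bool
boxEq (a , b) (c , d) = (a ≡ᵇ c) ∧ (b ≡ᵇ d)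

crossings : ℕ → Grid → ℕ → ℕ → ℕ
crossings n D p q =
  countB (λ b → D (proj₁ b) (proj₂ b) ∧ anyB (boxEq b) (proj₁ (pipe n D q)))
         (proj₁ (pipe n D p))

IsReduced : ℕ → Grid → Set
IsReduced n D = ∀ p q → 1 ≤ p → p < q → q ≤ n → crossings n D p q ≤ 1

InRP : (n : ℕ) → Permutation′ n → Grid → Set
InRP n w D = IsPipeDreamFor n w D × IsReduced n D

-- Pairing (common algorithm)
-- Elements of `xs` are processed in the given order; each is paired with the
-- first not-yet-paired element b of `avail` (listed in increasing order)
-- with  rel x b = true.

takeFirst : (ℕ → Bool) → List ℕ → Maybe (List ℕ)
takeFirst p [] = nothing
takeFirst p (b ∷ bs) with p b
... | true  = just bs
... | false with takeFirst p bs
...   | nothing  = nothing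
...   | just bs' = just (b ∷ bs')

unpaired : (ℕ → ℕ → Bool) → List ℕ → List ℕ → List ℕ
unpaired rel [] avail = []
unpaired rel (x ∷ xs) avail with takeFirst (rel x) avail
... | just avail' = unpaired rel xs avail'
... | nothing     = x ∷ unpaired rel xs avail

crossCols : ℕ → Grid → ℕ → List ℕ
crossCols n D i = filterB (D i) (oneTo n)

unpairedPD : ℕ → Grid → ℕ → List ℕ
unpairedPD n D i = unpaired (λ j c → j ≤ᵇ c) (reverse (crossCols n D i)) (crossCols n D (suc i))

zeroPDAt : Grid → ℕ → Maybe ℕ → Set
zeroPDAt D i nothing  = ⊤
zeroPDAt D i (just j) = ∀ k → 1 ≤ k → k ≤ j → D i k ≡ true

PDfZero : ℕ → Grid → ℕ → Set
PDfZero n D i = zeroPDAt D i (minL (unpairedPD n D i))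

-- r k is the block r^k (blocks are numbered 1..n-1; all other blocks empty)
Fact : Set
Fact = ℕ → List ℕ

HeadGeq : ℕ → List ℕ → Set
HeadGeq k [] = ⊤
HeadGeq k (x ∷ _) = k ≤ x

factWord : ℕ → Fact → List ℕ
factWord n r = concat (map r (map suc (downFrom (n ∸ 1))))

InRFC : (n : ℕ) → Permutation′ n → Fact → Set
InRFC n v r =
  (∀ k → (k ≡ 0 ⊎ n ≤ k) → r k ≡ [])
  × (∀ k → 1 ≤ k → k < n → Linked _<_ (r k) × HeadGeq k (r k))
  × IsReducedWord n v (factWord n r)

unpairedRF : Fact → ℕ → List ℕ
unpairedRF r i = unpaired (λ a b → a <ᵇ b) (reverse (r i)) (r (suc i))

-- t = max { z ≤ u : z - 1 ∉ r^i }   (z - 1 taken in ℤ, so z = 0 qualifies)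
tOf : List ℕ → ℕ → ℕ
tOf blk zero = zero
tOf blk (suc z) = if memℕ z blk then tOf blk z else suc z

removeOne : ℕ → List ℕ → List ℕ
removeOne u [] = []
removeOne u (x ∷ xs) = if u ≡ᵇ x then xs else x ∷ removeOne u xs

insertSorted : ℕ → List ℕ → List ℕ
insertSorted t [] = t ∷ []
insertSorted t (x ∷ xs) = if t ≤ᵇ x then t ∷ x ∷ xs else x ∷ insertSorted t xs

moveLetter : Fact → ℕ → ℕ → Fact
moveLetter r i u k =
  if k ≡ᵇ i then removeOne u (r i)
  else (if k ≡ᵇ suc i then insertSorted (tOf (r i) u) (r (suc i)) else r k)

zeroRFAt : (n : ℕ) → Permutation′ n → Fact → ℕ → Maybe ℕ → Set
zeroRFAt n v r i nothing  = ⊤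
zeroRFAt n v r i (just u) = ¬ InRFC n v (moveLetter r i u)

RFfZero : (n : ℕ) → Permutation′ n → Fact → ℕ → Set
RFfZero n v r i = zeroRFAt n v r i (minL (unpairedRF r i))

phi : ℕ → Grid → Fact
phi n D k = map (λ j → k + j ∸ 1) (crossCols n D k)

-- Reading the crosses of D row by row from the bottom, each cross (i, j) contributing the
-- letter i + j - 1, gives the word of φ(D).  The prefix of this word up to a box sends the
-- diagonal of the box to the entry rows of the pipes through it, so the whole word acts as
-- w⁻¹; since in a reduced pipe dream two pipes never meet twice, every cross is an ascent of
-- its prefix and the word is reduced.  The pairings of row i and of block i agree under
-- j ↦ i + j - 1, so the leftmost unpaired cross (i, j) gives the smallest unpaired letter.
-- If row i is full up to j, the moved letter lands in block i + 1 as i, breaking the cutoff.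
-- Otherwise, with c₀ the last elbow before j, pairing and reducedness force elbows at
-- (i+1, c₀) and (i+1, j) with crosses in between; moving the cross (i, j) to (i+1, c₀) gives
-- a pipe dream whose word differs by commutations and one braid move, so it is still a
-- reduced word of w⁻¹, and its image under φ is exactly f_i(φ(D)).

module Submission where

open import Data.Bool using (Bool; true; false; if_then_else_; _∧_)
open import Data.Empty using (⊥-elim)
open import Data.Fin as Fin using (Fin; toℕ)
open import Data.Fin.Permutation using (Permutation′; _⟨$⟩ʳ_; _⟨$⟩ˡ_; flip; inverseʳ)
open import Data.List using (List; []; _∷_; _++_; map; reverse; length; concat; applyUpTo; downFrom; tabulate; allFin)
open import Data.List.Properties
  using (map-++; map-cong; map-tabulate; ++-assoc; ++-identityʳ; length-++; length-++-sucʳ; unfold-reverse; reverse-map)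
open import Data.List.Membership.Propositional using (_∈_; _∉_)
open import Data.List.Membership.Propositional.Properties using (∈-++⁺ˡ; ∈-++⁺ʳ; ∈-++⁻; ∈-map⁺)
open import Data.List.Relation.Unary.All as All using (All; []; _∷_)
import Data.List.Relation.Unary.All.Properties as All
open import Data.List.Relation.Unary.AllPairs using (AllPairs; []; _∷_)
import Data.List.Relation.Unary.AllPairs.Properties as AllPairs
open import Data.List.Relation.Unary.Any using (here; there)
import Data.List.Relation.Unary.Any.Properties as Any
open import Data.List.Relation.Unary.Linked using (Linked)
open import Data.List.Relation.Unary.Linked.Properties using (AllPairs⇒Linked)
open import Data.Maybe as Maybe using (Maybe; just; nothing)
open import Data.Nat
open import Data.Nat.ListAction using (sum)
open import Data.Nat.Properties
open import Data.Product using (Σ; _×_; _,_; proj₁; proj₂; map₁; swap; uncurry)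
open import Data.Sum using (_⊎_; inj₁; inj₂; [_,_]′)
open import Data.Unit using (tt)
open import Function using (id; _∘_)
open import Function.Bundles using (_⇔_; mk⇔)
open import Relation.Binary.Definitions using (tri<; tri≈; tri>)
open import Relation.Binary.PropositionalEquality hiding ([_])
open import Relation.Nullary using (¬_; yes; no; contradiction)
open import Relation.Nullary.Decidable using (_×-dec_)
open import Relation.Nullary.Reflects using (Reflects; ofʸ; ofⁿ; fromEquivalence)

open import Defs

open ≡-Reasoning

module _ {P : Set} where

  reflects-true : ∀ {b} → Reflects P b → P → b ≡ true
  reflects-true (ofʸ _)  _ = refl
  reflects-true (ofⁿ ¬p) p = ⊥-elim (¬p p)

  reflects-false : ∀ {b} → Reflects P b → ¬ P → b ≡ false
  reflects-false (ofʸ p) ¬p = ⊥-elim (¬p p)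
  reflects-false (ofⁿ _) _  = refl

  reflects-true⁻ : ∀ {b} → Reflects P b → b ≡ true → P
  reflects-true⁻ (ofʸ p) _ = p

  reflects-false⁻ : ∀ {b} → Reflects P b → b ≡ false → ¬ P
  reflects-false⁻ (ofⁿ ¬p) _ = ¬p

if-true : ∀ {A : Set} {b} {x y : A} → b ≡ true → (if b then x else y) ≡ x
if-true refl = refl

if-false : ∀ {A : Set} {b} {x y : A} → b ≡ false → (if b then x else y) ≡ y
if-false refl = refl

≡ᵇ-reflects-≡ : ∀ m n → Reflects (m ≡ n) (m ≡ᵇ n)
≡ᵇ-reflects-≡ m n = fromEquivalence (≡ᵇ⇒≡ m n) (≡⇒≡ᵇ m n)

≡ᵇ-refl : ∀ n → (n ≡ᵇ n) ≡ true
≡ᵇ-refl n = reflects-true (≡ᵇ-reflects-≡ n n) refl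

≡ᵇ-≡ : ∀ {m n} → (m ≡ᵇ n) ≡ true → m ≡ n
≡ᵇ-≡ = reflects-true⁻ (≡ᵇ-reflects-≡ _ _)

≡ᵇ-≢ : ∀ {m n} → m ≢ n → (m ≡ᵇ n) ≡ false
≡ᵇ-≢ = reflects-false (≡ᵇ-reflects-≡ _ _)

<ᵇ-< : ∀ {m n} → m < n → (m <ᵇ n) ≡ true
<ᵇ-< = reflects-true (<ᵇ-reflects-< _ _)

<ᵇ-≥ : ∀ {m n} → n ≤ m → (m <ᵇ n) ≡ false
<ᵇ-≥ n≤m = reflects-false (<ᵇ-reflects-< _ _) (≤⇒≯ n≤m)

<ᵇ-<⁻ : ∀ {m n} → (m <ᵇ n) ≡ true → m < n
<ᵇ-<⁻ = reflects-true⁻ (<ᵇ-reflects-< _ _)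

≤ᵇ-≤ : ∀ {m n} → m ≤ n → (m ≤ᵇ n) ≡ true
≤ᵇ-≤ = reflects-true (≤ᵇ-reflects-≤ _ _)

≤ᵇ-> : ∀ {m n} → n < m → (m ≤ᵇ n) ≡ false
≤ᵇ-> n<m = reflects-false (≤ᵇ-reflects-≤ _ _) (<⇒≱ n<m)

≤ᵇ-≤⁻ : ∀ {m n} → (m ≤ᵇ n) ≡ true → m ≤ n
≤ᵇ-≤⁻ = reflects-true⁻ (≤ᵇ-reflects-≤ _ _)

≤ᵇ->⁻ : ∀ {m n} → (m ≤ᵇ n) ≡ false → n < m
≤ᵇ->⁻ e = ≰⇒> (reflects-false⁻ (≤ᵇ-reflects-≤ _ _) e)

module _ {A : Set} where

  filterB-++ : ∀ (p : A → Bool) xs ys → filterB p (xs ++ ys) ≡ filterB p xs ++ filterB p ys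
  filterB-++ p [] ys = refl
  filterB-++ p (x ∷ xs) ys with p x
  ... | true  = cong (x ∷_) (filterB-++ p xs ys)
  ... | false = filterB-++ p xs ys

  filterB-cong : ∀ {p q : A → Bool} {xs} → All (λ x → p x ≡ q x) xs → filterB p xs ≡ filterB q xs
  filterB-cong [] = refl
  filterB-cong {p} {q} {x ∷ xs} (e ∷ es) rewrite e with q x
  ... | true  = cong (x ∷_) (filterB-cong es)
  ... | false = filterB-cong es

  filterB-none : ∀ {p : A → Bool} {xs} → All (λ x → p x ≡ false) xs → filterB p xs ≡ []
  filterB-none [] = refl
  filterB-none {p} (e ∷ es) rewrite e = filterB-none es

  All-filterB : ∀ {P : A → Set} (p : A → Bool) {xs} → All P xs → All P (filterB p xs)
  All-filterB p [] = []
  All-filterB p {x ∷ _} (px ∷ pxs) with p x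
  ... | true  = px ∷ All-filterB p pxs
  ... | false = All-filterB p pxs

  ∈-filterB⁺ : ∀ (p : A → Bool) {xs x} → x ∈ xs → p x ≡ true → x ∈ filterB p xs
  ∈-filterB⁺ p (here refl) e rewrite e = here refl
  ∈-filterB⁺ p {y ∷ _} (there x∈) e with p y
  ... | true  = there (∈-filterB⁺ p x∈ e)
  ... | false = ∈-filterB⁺ p x∈ e

  ∈-filterB⁻ : ∀ (p : A → Bool) xs {x} → x ∈ filterB p xs → x ∈ xs × p x ≡ true
  ∈-filterB⁻ p (y ∷ xs) x∈ with p y in e
  ∈-filterB⁻ p (y ∷ xs) (here refl) | true = here refl , e
  ∈-filterB⁻ p (y ∷ xs) (there x∈) | true = map₁ there (∈-filterB⁻ p xs x∈)
  ... | false = map₁ there (∈-filterB⁻ p xs x∈)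

  countB-≥1 : ∀ (p : A → Bool) {xs x} → x ∈ xs → p x ≡ true → 1 ≤ countB p xs
  countB-≥1 p (here refl) e rewrite e = s≤s z≤n
  countB-≥1 p {y ∷ _} (there x∈) e with p y
  ... | true  = s≤s z≤n
  ... | false = countB-≥1 p x∈ e

  countB-≥2 : ∀ (p : A → Bool) {xs x y} → x ∈ xs → y ∈ xs → x ≢ y →
              p x ≡ true → p y ≡ true → 2 ≤ countB p xs
  countB-≥2 p (here refl) (here refl) x≢y _ _ = ⊥-elim (x≢y refl)
  countB-≥2 p (here refl) (there y∈) _ ex ey rewrite ex = s≤s (countB-≥1 p y∈ ey)
  countB-≥2 p (there x∈) (here refl) _ ex ey rewrite ey = s≤s (countB-≥1 p x∈ ex)
  countB-≥2 p {z ∷ _} (there x∈) (there y∈) x≢y ex ey with p z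
  ... | true  = m≤n⇒m≤1+n (countB-≥2 p x∈ y∈ x≢y ex ey)
  ... | false = countB-≥2 p x∈ y∈ x≢y ex ey

  anyB-∈ : ∀ (p : A → Bool) {xs x} → x ∈ xs → p x ≡ true → anyB p xs ≡ true
  anyB-∈ p (here refl) e rewrite e = refl
  anyB-∈ p {y ∷ _} (there x∈) e with p y
  ... | true  = refl
  ... | false = anyB-∈ p x∈ e

  anyB-none : ∀ (p : A → Bool) {xs} → All (λ x → p x ≡ false) xs → anyB p xs ≡ false
  anyB-none p [] = refl
  anyB-none p (e ∷ es) rewrite e = anyB-none p es

memℕ-∈ : ∀ {x xs} → x ∈ xs → memℕ x xs ≡ true
memℕ-∈ {x} x∈ = anyB-∈ (x ≡ᵇ_) x∈ (≡ᵇ-refl x)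

memℕ-∉ : ∀ {x xs} → All (x ≢_) xs → memℕ x xs ≡ false
memℕ-∉ {x} ne = anyB-none (x ≡ᵇ_) (All.map ≡ᵇ-≢ ne)

boxEq-refl : ∀ b → boxEq b b ≡ true
boxEq-refl (r , c) rewrite ≡ᵇ-refl r | ≡ᵇ-refl c = refl

AllPairs-reverse : ∀ {xs : List ℕ} → AllPairs _<_ xs → AllPairs _>_ (reverse xs)
AllPairs-reverse [] = []
AllPairs-reverse {x ∷ xs} (x< ∷ sorted) =
  subst (AllPairs _>_) (sym (unfold-reverse x xs))
    (AllPairs.++⁺ (AllPairs-reverse sorted) ([] ∷ [])
      (All.map (_∷ []) (All.tabulate (λ y∈ → All.lookup x< (Any.reverse⁻ y∈)))))

minL-nothing : ∀ xs → minL xs ≡ nothing → xs ≡ []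
minL-nothing [] _ = refl
minL-nothing (x ∷ xs) e with minL xs
minL-nothing (x ∷ xs) () | nothing
minL-nothing (x ∷ xs) () | just _

minL-just : ∀ xs {m} → minL xs ≡ just m → m ∈ xs × All (m ≤_) xs
minL-just (x ∷ xs) e with minL xs in e′
minL-just (x ∷ xs) refl | nothing with refl ← minL-nothing xs e′ = here refl , ≤-refl ∷ []
minL-just (x ∷ xs) refl | just m with m∈ , m≤ ← minL-just xs e′ =
  [ here , (λ q → there (subst (_∈ xs) (sym q) m∈)) ]′ (⊓-sel x m) ,
  m≤n⇒m⊓o≤n m ≤-refl ∷ All.map (≤-trans (m⊓n≤n x m)) m≤

minL-map : ∀ (f : ℕ → ℕ) → (∀ {x y} → x ≤ y → f x ≤ f y) → ∀ xs → minL (map f xs) ≡ Maybe.map f (minL xs)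
minL-map f mono [] = refl
minL-map f mono (x ∷ xs) rewrite minL-map f mono xs with minL xs
... | nothing = refl
... | just m  = cong just (sym (mono-≤-distrib-⊓ mono x m))

∈-unremove : ∀ {x : ℕ} pre {b} post → x ∈ pre ++ post → x ∈ pre ++ b ∷ post
∈-unremove pre post x∈ = [ ∈-++⁺ˡ , ∈-++⁺ʳ pre ∘ there ]′ (∈-++⁻ pre x∈)

∈-remove : ∀ {x : ℕ} pre {b} post → x ∈ pre ++ b ∷ post → x ≢ b → x ∈ pre ++ post
∈-remove pre post x∈ x≢b with ∈-++⁻ pre x∈
... | inj₁ x∈pre         = ∈-++⁺ˡ x∈pre
... | inj₂ (here x≡b)    = ⊥-elim (x≢b x≡b)
... | inj₂ (there x∈post) = ∈-++⁺ʳ pre x∈post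

AllPairs-remove : ∀ {R : ℕ → ℕ → Set} pre {b : ℕ} post → AllPairs R (pre ++ b ∷ post) → AllPairs R (pre ++ post)
AllPairs-remove []        post (_ ∷ sorted)  = sorted
AllPairs-remove (x ∷ pre) post (x< ∷ sorted) = All-remove pre x< ∷ AllPairs-remove pre post sorted
  where
  All-remove : ∀ {P : ℕ → Set} pre {b post} → All P (pre ++ b ∷ post) → All P (pre ++ post)
  All-remove []        (_ ∷ ps) = ps
  All-remove (_ ∷ pre) (p ∷ ps) = p ∷ All-remove pre ps

AllPairs-after : ∀ {R : ℕ → ℕ → Set} pre {b : ℕ} post → AllPairs R (pre ++ b ∷ post) → All (R b) post
AllPairs-after []        post (b< ∷ _)   = b<
AllPairs-after (x ∷ pre) post (_ ∷ sorted) = AllPairs-after pre post sorted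

range : ℕ → ℕ → List ℕ
range s zero    = []
range s (suc m) = s ∷ range (suc s) m

oneTo≡range : ∀ n → oneTo n ≡ range 1 n
oneTo≡range n = go id 0 n (λ _ → refl)
  where
  go : ∀ (f : ℕ → ℕ) s m → (∀ x → f x ≡ s + x) → map suc (applyUpTo f m) ≡ range (suc s) m
  go f s zero    f≗ = refl
  go f s (suc m) f≗ = cong₂ _∷_ (cong suc (trans (f≗ 0) (+-identityʳ s)))
                               (go (f ∘ suc) (suc s) m (λ x → trans (f≗ (suc x)) (+-suc s x)))

range-++ : ∀ s m k → range s (m + k) ≡ range s m ++ range (s + m) k
range-++ s zero    k = cong (λ z → range z k) (sym (+-identityʳ s))
range-++ s (suc m) k =
  cong (s ∷_) (trans (range-++ (suc s) m k) (cong (λ z → range (suc s) m ++ range z k) (sym (+-suc s m))))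

range-snoc : ∀ s m → range s (suc m) ≡ range s m ++ (s + m) ∷ []
range-snoc s m = trans (cong (range s) (+-comm 1 m)) (range-++ s m 1)

range-bounds : ∀ s m → All (λ x → s ≤ x × x < s + m) (range s m)
range-bounds s zero    = []
range-bounds s (suc m) = (≤-refl , subst (s <_) (sym (+-suc s m)) (s≤s (m≤m+n s m)))
  ∷ All.map (λ {x} p → <⇒≤ (proj₁ p) , subst (x <_) (sym (+-suc s m)) (proj₂ p)) (range-bounds (suc s) m)

∈-range⁺ : ∀ s m {z} → s ≤ z → z < s + m → z ∈ range s m
∈-range⁺ s zero    s≤z z< = ⊥-elim (<⇒≱ z< (subst (_≤ _) (sym (+-identityʳ s)) s≤z))
∈-range⁺ s (suc m) {z} s≤z z< with m≤n⇒m<n∨m≡n s≤z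
... | inj₂ refl = here refl
... | inj₁ s<z  = there (∈-range⁺ (suc s) m s<z (subst (z <_) (+-suc s m) z<))

data SᵢView (a y : ℕ) : Set where
  at-a     : y ≡ a → sᵢ a y ≡ suc a → SᵢView a y
  at-suc-a : y ≡ suc a → sᵢ a y ≡ a → SᵢView a y
  fixed    : y ≢ a → y ≢ suc a → sᵢ a y ≡ y → SᵢView a y

sᵢ-view : ∀ a y → SᵢView a y
sᵢ-view a y with y ≡ᵇ a in e₁ | y ≡ᵇ suc a in e₂
... | true  | _     = at-a (≡ᵇ-≡ e₁) (if-true e₁)
... | false | true  = at-suc-a (≡ᵇ-≡ e₂) (trans (if-false e₁) (if-true e₂))
... | false | false = fixed (reflects-false⁻ (≡ᵇ-reflects-≡ y a) e₁)
                            (reflects-false⁻ (≡ᵇ-reflects-≡ y (suc a)) e₂)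
                            (trans (if-false e₁) (if-false e₂))

sᵢ-left : ∀ a → sᵢ a a ≡ suc a
sᵢ-left a rewrite ≡ᵇ-refl a = refl

sᵢ-right : ∀ a → sᵢ a (suc a) ≡ a
sᵢ-right a rewrite ≡ᵇ-≢ (1+n≢n {a}) | ≡ᵇ-refl a = refl

sᵢ-involutive : ∀ a y → sᵢ a (sᵢ a y) ≡ y
sᵢ-involutive a y with sᵢ-view a y
... | at-a refl e     rewrite e = sᵢ-right a
... | at-suc-a refl e rewrite e = sᵢ-left a
... | fixed _ _ e     rewrite e = e

Apart : ℕ → ℕ → Set
Apart a y = y < a ⊎ suc a < y

sᵢ-apart : ∀ a {y} → Apart a y → sᵢ a y ≡ y
sᵢ-apart a {y} apart with sᵢ-view a y
... | at-a refl _     = ⊥-elim ([ <-irrefl refl , (λ p → <-asym p (n<1+n a)) ]′ apart)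
... | at-suc-a refl _ = ⊥-elim ([ (λ p → <-asym p (n<1+n a)) , <-irrefl refl ]′ apart)
... | fixed _ _ e     = e

sᵢ-< : ∀ a {x y} → x < y → (x ≡ a × y ≡ suc a) ⊎ sᵢ a x < sᵢ a y
sᵢ-< a {x} {y} x<y with sᵢ-view a x | sᵢ-view a y
... | at-a refl _ | at-a refl _ = ⊥-elim (<-irrefl refl x<y)
... | at-a refl _ | at-suc-a refl _ = inj₁ (refl , refl)
... | at-a refl ex | fixed _ y≢ ey rewrite ex | ey = inj₂ (≤∧≢⇒< x<y (y≢ ∘ sym))
... | at-suc-a refl _ | at-a refl _ = ⊥-elim (<-asym x<y (n<1+n a))
... | at-suc-a refl _ | at-suc-a refl _ = ⊥-elim (<-irrefl refl x<y)
... | at-suc-a refl ex | fixed _ _ ey rewrite ex | ey = inj₂ (<-trans (n<1+n a) x<y)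
... | fixed _ _ ex | at-a refl ey rewrite ex | ey = inj₂ (<-trans x<y (n<1+n a))
... | fixed x≢ _ ex | at-suc-a refl ey rewrite ex | ey = inj₂ (≤∧≢⇒< (≤-pred x<y) x≢)
... | fixed _ _ ex | fixed _ _ ey rewrite ex | ey = inj₂ x<y

sᵢ-comm : ∀ a b {z} → suc (suc a) ≤ b → sᵢ a (sᵢ b z) ≡ sᵢ b (sᵢ a z)
sᵢ-comm a b {z} a+2≤b with sᵢ-view b z | sᵢ-view a z
... | at-a refl eb | _ rewrite eb
  | sᵢ-apart a {suc b} (inj₂ (m≤n⇒m≤1+n a+2≤b)) | sᵢ-apart a {b} (inj₂ a+2≤b) = sym eb
... | at-suc-a refl eb | _ rewrite eb
  | sᵢ-apart a {b} (inj₂ a+2≤b) | sᵢ-apart a {suc b} (inj₂ (m≤n⇒m≤1+n a+2≤b)) = sym eb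
... | fixed _ _ eb | at-a refl ea rewrite eb | ea = sym (sᵢ-apart b (inj₁ a+2≤b))
... | fixed _ _ eb | at-suc-a refl ea rewrite eb | ea = sym (sᵢ-apart b (inj₁ (<-trans (n<1+n a) a+2≤b)))
... | fixed _ _ eb | fixed _ _ ea rewrite eb | ea = sym eb

sᵢ-≥ : ∀ {m} a {y} → m ≤ a → m ≤ y → m ≤ sᵢ a y
sᵢ-≥ a {y} m≤a m≤y with sᵢ-view a y
... | at-a _ e     rewrite e = m≤n⇒m≤1+n m≤a
... | at-suc-a _ e rewrite e = m≤a
... | fixed _ _ e  rewrite e = m≤y

sᵢ-≤ : ∀ {n} a {y} → suc a ≤ n → y ≤ n → sᵢ a y ≤ n
sᵢ-≤ a {y} a<n y≤n with sᵢ-view a y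
... | at-a _ e     rewrite e = a<n
... | at-suc-a _ e rewrite e = <⇒≤ a<n
... | fixed _ _ e  rewrite e = y≤n

actWord-++ : ∀ xs ys y → actWord (xs ++ ys) y ≡ actWord xs (actWord ys y)
actWord-++ []       ys y = refl
actWord-++ (x ∷ xs) ys y = cong (sᵢ x) (actWord-++ xs ys y)

actWord-apart : ∀ ws {y} → All (λ a → Apart a y) ws → actWord ws y ≡ y
actWord-apart []       []       = refl
actWord-apart (a ∷ ws) (p ∷ ps) rewrite actWord-apart ws ps = sᵢ-apart a p

actWord-≥ : ∀ {m} ws {y} → All (m ≤_) ws → m ≤ y → m ≤ actWord ws y
actWord-≥ []       []       m≤y = m≤y
actWord-≥ (a ∷ ws) (p ∷ ps) m≤y = sᵢ-≥ a p (actWord-≥ ws ps m≤y)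

actWord-≤ : ∀ {n} ws {y} → All (λ a → suc a ≤ n) ws → y ≤ n → actWord ws y ≤ n
actWord-≤ []       []       y≤n = y≤n
actWord-≤ (a ∷ ws) (p ∷ ps) y≤n = sᵢ-≤ a p (actWord-≤ ws ps y≤n)

actWord-injective : ∀ ws {x y} → actWord ws x ≡ actWord ws y → x ≡ y
actWord-injective []       e = e
actWord-injective (a ∷ ws) e =
  actWord-injective ws (trans (sym (sᵢ-involutive a _)) (trans (cong (sᵢ a) e) (sᵢ-involutive a _)))

actWord-comm : ∀ b xs ys → All (λ x → suc (suc x) ≤ b) xs → All (b ≤_) ys →
               ∀ z → actWord xs (actWord ys z) ≡ actWord ys (actWord xs z)
actWord-comm b []       ys []       _  z = refl
actWord-comm b (a ∷ xs) ys (p ∷ ps) qs z =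
  trans (cong (sᵢ a) (actWord-comm b xs ys ps qs z)) (commute ys (All.map (≤-trans p) qs))
  where
  commute : ∀ ys {z} → All (suc (suc a) ≤_) ys → sᵢ a (actWord ys z) ≡ actWord ys (sᵢ a z)
  commute []       []       = refl
  commute (b ∷ ys) {z} (q ∷ qs) = trans (sᵢ-comm a b {actWord ys z} q) (cong (sᵢ b) (commute ys qs))

-- The word s_s s_{s+1} ⋯ s_{s+m-1} acts as the cycle s+m ↦ s ↦ s+1 ↦ ⋯ ↦ s+m.

cycle-below : ∀ s m {y} → y < s → actWord (range s m) y ≡ y
cycle-below s m y<s = actWord-apart _ (All.map (λ q → inj₁ (<-≤-trans y<s (proj₁ q))) (range-bounds s m))

cycle-above : ∀ s m {y} → s + m < y → actWord (range s m) y ≡ y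
cycle-above s m s+m<y = actWord-apart _ (All.map (λ q → inj₂ (≤-<-trans (proj₂ q) s+m<y)) (range-bounds s m))

cycle-top : ∀ s m → actWord (range s m) (s + m) ≡ s
cycle-top s zero    = +-identityʳ s
cycle-top s (suc m) rewrite +-suc s m | cycle-top (suc s) m = sᵢ-right s

cycle-shift : ∀ s m {y} → s ≤ y → y < s + m → actWord (range s m) y ≡ suc y
cycle-shift s zero    s≤y y< = ⊥-elim (<⇒≱ y< (subst (_≤ _) (sym (+-identityʳ s)) s≤y))
cycle-shift s (suc m) {y} s≤y y< with m≤n⇒m<n∨m≡n s≤y
... | inj₂ refl rewrite cycle-below (suc s) m (n<1+n s) = sᵢ-left s
... | inj₁ s<y  rewrite cycle-shift (suc s) m s<y (subst (y <_) (+-suc s m) y<) = sᵢ-apart s (inj₂ (s≤s s<y))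

data CycleView (t m y : ℕ) : Set where
  lower    : y < t → CycleView t m y
  middle   : t ≤ y → y < t + m → CycleView t m y
  end      : y ≡ t + m → CycleView t m y
  past-end : y ≡ suc (t + m) → CycleView t m y
  higher   : suc (t + m) < y → CycleView t m y

cycle-view : ∀ t m y → CycleView t m y
cycle-view t m y with y <? t | y <? t + m | y ≟ t + m | y ≟ suc (t + m)
... | yes y<t | _ | _ | _ = lower y<t
... | no y≮t | yes y< | _ | _ = middle (≮⇒≥ y≮t) y<
... | no _ | no _ | yes y≡ | _ = end y≡
... | no _ | no _ | no _ | yes y≡ = past-end y≡
... | no _ | no y≮ | no y≢ | no y≢′ = higher (≤∧≢⇒< (≤∧≢⇒< (≮⇒≥ y≮) (y≢ ∘ sym)) (y≢′ ∘ sym))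

-- The braid relation s_t s_{t+1} s_t = s_{t+1} s_t s_{t+1}, stretched to cycles.
cycle-braid : ∀ t m y → actWord (range (suc t) m) (actWord (range t (suc m)) y)
                      ≡ actWord (range t (suc m)) (actWord (range t m) y)
cycle-braid t m y with cycle-view t m y
... | lower y<t
  rewrite cycle-below t (suc m) y<t | cycle-below (suc t) m (m<n⇒m<1+n y<t) | cycle-below t m y<t
  = sym (cycle-below t (suc m) y<t)
... | middle t≤y y<
  rewrite cycle-shift t (suc m) t≤y (subst (y <_) (sym (+-suc t m)) (m<n⇒m<1+n y<))
        | cycle-shift (suc t) m (s≤s t≤y) (s≤s y<) | cycle-shift t m t≤y y<
  = sym (cycle-shift t (suc m) (m≤n⇒m≤1+n t≤y) (subst (suc y <_) (sym (+-suc t m)) (s≤s y<)))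
... | end refl
  rewrite cycle-shift t (suc m) (m≤m+n t m) (subst (t + m <_) (sym (+-suc t m)) (n<1+n _))
        | cycle-top (suc t) m | cycle-top t m
  = sym (cycle-shift t (suc m) ≤-refl (subst (t <_) (sym (+-suc t m)) (s≤s (m≤m+n t m))))
... | past-end refl
  rewrite sym (+-suc t m) | cycle-top t (suc m) | cycle-below (suc t) m (n<1+n t)
        | cycle-above t m {t + suc m} (subst (t + m <_) (sym (+-suc t m)) (n<1+n _))
  = sym (cycle-top t (suc m))
... | higher y>
  rewrite cycle-above t (suc m) (subst (_< y) (sym (+-suc t m)) y>) | cycle-above (suc t) m y>
        | cycle-above t m (<-trans (n<1+n _) y>)
  = sym (cycle-above t (suc m) (subst (_< y) (sym (+-suc t m)) y>))

-- A chute move on words: the letter t + m ending the run t, …, t + m of the upper row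
-- becomes the letter t in front of the run t + 1, …, t + m of the lower row.
chute-word : ∀ A B C E t m → All (λ x → 2 + x ≤ t) C → All (2 + (t + m) ≤_) B → ∀ z →
  actWord (A ++ t ∷ range (suc t) m ++ B) (actWord (C ++ range t m ++ E) z)
  ≡ actWord (A ++ range (suc t) m ++ B) (actWord (C ++ range t m ++ (t + m) ∷ E) z)
chute-word A B C E t m C≪t U≪B z = begin
  actWord (A ++ t ∷ Rs ++ B) (actWord (C ++ R0m ++ E) z)
    ≡⟨ act₃ A (t ∷ Rs) B _ ⟩
  actWord A (actWord R0 (actWord B (actWord (C ++ R0m ++ E) z)))
    ≡⟨ cong (actWord A ∘ actWord R0 ∘ actWord B) (act₃ C R0m E z) ⟩
  actWord A (actWord R0 (actWord B (actWord C (actWord R0m e))))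
    ≡⟨ cong (actWord A ∘ actWord R0 ∘ actWord B) (actWord-comm t C R0m C≪t R0m≥t e) ⟩
  actWord A (actWord R0 (actWord B (actWord R0m (actWord C e))))
    ≡⟨ cong (actWord A ∘ actWord R0) (actWord-comm (2 + U) R0m B R0m≪B U≪B (actWord C e)) ⟨
  actWord A (actWord R0 (actWord R0m v))
    ≡⟨ cong (actWord A) (cycle-braid t m v) ⟨
  actWord A (actWord Rs (actWord R0 v))
    ≡⟨ cong (actWord A ∘ actWord Rs) (actWord-comm (2 + U) R0 B R0≪B U≪B (actWord C e)) ⟩
  actWord A (actWord Rs (actWord B (actWord R0 (actWord C e))))
    ≡⟨ cong (actWord A ∘ actWord Rs ∘ actWord B) (actWord-comm t C R0 C≪t R0≥t e) ⟨
  actWord A (actWord Rs (actWord B (actWord C (actWord R0 e))))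
    ≡⟨ cong (λ l → actWord A (actWord Rs (actWord B (actWord C (actWord l e))))) (range-snoc t m) ⟩
  actWord A (actWord Rs (actWord B (actWord C (actWord (R0m ++ U ∷ []) e))))
    ≡⟨ cong (actWord A ∘ actWord Rs ∘ actWord B ∘ actWord C) (actWord-++ R0m (U ∷ []) e) ⟩
  actWord A (actWord Rs (actWord B (actWord C (actWord R0m (actWord (U ∷ E) z)))))
    ≡⟨ cong (actWord A ∘ actWord Rs ∘ actWord B) (act₃ C R0m (U ∷ E) z) ⟨
  actWord A (actWord Rs (actWord B (actWord (C ++ R0m ++ U ∷ E) z)))
    ≡⟨ act₃ A Rs B _ ⟨
  actWord (A ++ Rs ++ B) (actWord (C ++ R0m ++ U ∷ E) z) ∎
  where
  U : ℕ
  U = t + m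
  Rs : List ℕ
  Rs = range (suc t) m
  R0 : List ℕ
  R0 = range t (suc m)
  R0m : List ℕ
  R0m = range t m
  e : ℕ
  e = actWord E z
  v : ℕ
  v = actWord B (actWord C e)
  act₃ : ∀ xs ys zs y → actWord (xs ++ ys ++ zs) y ≡ actWord xs (actWord ys (actWord zs y))
  act₃ xs ys zs y = trans (actWord-++ xs _ y) (cong (actWord xs) (actWord-++ ys zs y))
  R0m≥t : All (t ≤_) R0m
  R0m≥t = All.map proj₁ (range-bounds t m)
  R0≥t : All (t ≤_) R0
  R0≥t = All.map proj₁ (range-bounds t (suc m))
  R0m≪B : All (λ x → 2 + x ≤ 2 + U) R0m
  R0m≪B = All.map (λ p → s≤s (≤-trans (proj₂ p) (n≤1+n _))) (range-bounds t m)
  R0≪B : All (λ x → 2 + x ≤ 2 + U) R0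
  R0≪B = All.map (λ {x} p → s≤s (subst (suc x ≤_) (+-suc t m) (proj₂ p))) (range-bounds t (suc m))

-- Inversion counts

ind : Bool → ℕ
ind b = if b then 1 else 0

sumBy : (ℕ → ℕ) → List ℕ → ℕ
sumBy h []       = 0
sumBy h (x ∷ xs) = h x + sumBy h xs

module _ {h h′ : ℕ → ℕ} where

  sumBy-congᴬ : ∀ {xs} → All (λ x → h x ≡ h′ x) xs → sumBy h xs ≡ sumBy h′ xs
  sumBy-congᴬ []       = refl
  sumBy-congᴬ (e ∷ es) = cong₂ _+_ e (sumBy-congᴬ es)

  sumBy-cong : (∀ x → h x ≡ h′ x) → ∀ xs → sumBy h xs ≡ sumBy h′ xs
  sumBy-cong h≗ []       = refl
  sumBy-cong h≗ (x ∷ xs) = cong₂ _+_ (h≗ x) (sumBy-cong h≗ xs)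

  sumBy-+ : ∀ xs → sumBy (λ x → h x + h′ x) xs ≡ sumBy h xs + sumBy h′ xs
  sumBy-+ []       = refl
  sumBy-+ (x ∷ xs) rewrite sumBy-+ xs = +-assoc-interchange (h x) (h′ x) (sumBy h xs) (sumBy h′ xs)
    where
    +-assoc-interchange : ∀ a b c d → a + b + (c + d) ≡ a + c + (b + d)
    +-assoc-interchange a b c d = begin
      a + b + (c + d)   ≡⟨ +-assoc a b (c + d) ⟩
      a + (b + (c + d)) ≡⟨ cong (a +_) (+-comm b (c + d)) ⟩
      a + (c + d + b)   ≡⟨ cong (a +_) (+-assoc c d b) ⟩
      a + (c + (d + b)) ≡⟨ cong (λ z → a + (c + z)) (+-comm d b) ⟩
      a + (c + (b + d)) ≡⟨ +-assoc a c (b + d) ⟨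
      a + c + (b + d)   ∎

sumBy-++ : ∀ (h : ℕ → ℕ) xs ys → sumBy h (xs ++ ys) ≡ sumBy h xs + sumBy h ys
sumBy-++ h []       ys = refl
sumBy-++ h (x ∷ xs) ys rewrite sumBy-++ h xs ys = sym (+-assoc (h x) _ _)

sumBy-zeroᴬ : ∀ {h : ℕ → ℕ} {xs} → All (λ x → h x ≡ 0) xs → sumBy h xs ≡ 0
sumBy-zeroᴬ []       = refl
sumBy-zeroᴬ (e ∷ es) rewrite e = sumBy-zeroᴬ es

sumBy-zero : ∀ {h : ℕ → ℕ} → (∀ x → h x ≡ 0) → ∀ xs → sumBy h xs ≡ 0
sumBy-zero h≗0 []       = refl
sumBy-zero h≗0 (x ∷ xs) rewrite h≗0 x = sumBy-zero h≗0 xs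

sumBy-sᵢ : ∀ (h : ℕ → ℕ) {n a} → 1 ≤ a → suc a ≤ n → sumBy (h ∘ sᵢ a) (range 1 n) ≡ sumBy h (range 1 n)
sumBy-sᵢ h {a = suc a} _ a<n with k , refl ← m≤n⇒∃[o]m+o≡n a<n = begin
  sumBy (h ∘ sᵢ (suc a)) (range 1 (2 + a + k))
    ≡⟨ cong (sumBy _) split ⟩
  sumBy (h ∘ sᵢ (suc a)) (L ++ suc a ∷ suc (suc a) ∷ R)
    ≡⟨ sumBy-++ _ L _ ⟩
  sumBy (h ∘ sᵢ (suc a)) L + (h (sᵢ (suc a) (suc a)) + (h (sᵢ (suc a) (suc (suc a))) + sumBy (h ∘ sᵢ (suc a)) R))
    ≡⟨ cong₂ _+_ outside-L swapped ⟩
  sumBy h L + (h (suc a) + (h (suc (suc a)) + sumBy h R))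
    ≡⟨ sumBy-++ h L _ ⟨
  sumBy h (L ++ suc a ∷ suc (suc a) ∷ R)
    ≡⟨ cong (sumBy h) split ⟨
  sumBy h (range 1 (2 + a + k)) ∎
  where
  L : List ℕ
  L = range 1 a
  R : List ℕ
  R = range (3 + a) k
  split : range 1 (2 + a + k) ≡ L ++ suc a ∷ suc (suc a) ∷ R
  split = trans (cong (range 1) (sym (trans (+-suc a (suc k)) (cong suc (+-suc a k))))) (range-++ 1 a (2 + k))
  outside-L : sumBy (h ∘ sᵢ (suc a)) L ≡ sumBy h L
  outside-L = sumBy-congᴬ (All.map (λ p → cong h (sᵢ-apart (suc a) (inj₁ (proj₂ p)))) (range-bounds 1 a))
  outside-R : sumBy (h ∘ sᵢ (suc a)) R ≡ sumBy h R
  outside-R = sumBy-congᴬ (All.map (λ p → cong h (sᵢ-apart (suc a) (inj₂ (proj₁ p)))) (range-bounds (3 + a) k))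
  swapped : h (sᵢ (suc a) (suc a)) + (h (sᵢ (suc a) (suc (suc a))) + sumBy (h ∘ sᵢ (suc a)) R)
         ≡ h (suc a) + (h (suc (suc a)) + sumBy h R)
  swapped rewrite sᵢ-left (suc a) | sᵢ-right (suc a) | outside-R =
    trans (sym (+-assoc (h (suc (suc a))) _ _))
      (trans (cong (_+ sumBy h R) (+-comm (h (suc (suc a))) _)) (+-assoc (h (suc a)) _ _))

sumBy-indicator : ∀ {n v} → 1 ≤ v → v ≤ n → sumBy (λ y → ind (y ≡ᵇ v)) (range 1 n) ≡ 1
sumBy-indicator {v = suc v} _ v≤n with k , refl ← m≤n⇒∃[o]m+o≡n v≤n = begin
  sumBy δ (range 1 (suc v + k))               ≡⟨ cong (sumBy δ) (cong (range 1) (sym (+-suc v k))) ⟩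
  sumBy δ (range 1 (v + suc k))               ≡⟨ cong (sumBy δ) (range-++ 1 v (suc k)) ⟩
  sumBy δ (range 1 v ++ suc v ∷ range (2 + v) k) ≡⟨ sumBy-++ δ (range 1 v) _ ⟩
  sumBy δ (range 1 v) + (δ (suc v) + sumBy δ (range (2 + v) k))
    ≡⟨ cong₂ _+_ (sumBy-zeroᴬ (All.map (λ p → cong ind (≡ᵇ-≢ (<⇒≢ (s≤s (proj₂ p))))) (range-bounds 1 v)))
                 (cong₂ _+_ (cong ind (≡ᵇ-refl v))
                            (sumBy-zeroᴬ (All.map (λ p → cong ind (≡ᵇ-≢ (>⇒≢ (proj₁ p)))) (range-bounds (2 + v) k)))) ⟩
  1 ∎
  where
  δ : ℕ → ℕ
  δ y = ind (y ≡ᵇ suc v)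

inversions : ℕ → (ℕ → ℕ) → ℕ
inversions n g = sumBy (λ x → sumBy (λ y → ind ((x <ᵇ y) ∧ (g y <ᵇ g x))) (range 1 n)) (range 1 n)

inversions-cong : ∀ n {g g′ : ℕ → ℕ} → (∀ y → g y ≡ g′ y) → inversions n g ≡ inversions n g′
inversions-cong n g≗ =
  sumBy-cong (λ x → sumBy-cong (λ y → cong₂ (λ u v → ind ((x <ᵇ y) ∧ (u <ᵇ v))) (g≗ y) (g≗ x)) (range 1 n)) (range 1 n)

inversions-id : ∀ n → inversions n id ≡ 0
inversions-id n = sumBy-zero (λ x → sumBy-zero (λ y → cong ind (asym x y)) (range 1 n)) (range 1 n)
  where
  asym : ∀ x y → ((x <ᵇ y) ∧ (y <ᵇ x)) ≡ false
  asym x y with x <ᵇ y in e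
  ... | true  = <ᵇ-≥ {y} {x} (<⇒≤ (<ᵇ-<⁻ e))
  ... | false = refl

sᵢ-<ᵇ : ∀ a x y → ¬ (x ≡ a × y ≡ suc a) → ¬ (y ≡ a × x ≡ suc a) → (sᵢ a x <ᵇ sᵢ a y) ≡ (x <ᵇ y)
sᵢ-<ᵇ a x y not-xy not-yx with <-cmp x y
... | tri< x<y _ _ = trans (<ᵇ-< ([ ⊥-elim ∘ not-xy , id ]′ (sᵢ-< a x<y))) (sym (<ᵇ-< x<y))
... | tri≈ _ refl _ = trans (<ᵇ-≥ {sᵢ a x} ≤-refl) (sym (<ᵇ-≥ {x} ≤-refl))
... | tri> _ _ y<x = trans (<ᵇ-≥ (<⇒≤ ([ ⊥-elim ∘ not-yx , id ]′ (sᵢ-< a y<x)))) (sym (<ᵇ-≥ (<⇒≤ y<x)))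

≡ᵇ-∧-false : ∀ {x u y v} → ¬ (x ≡ u × y ≡ v) → ((x ≡ᵇ u) ∧ (y ≡ᵇ v)) ≡ false
≡ᵇ-∧-false {x} {u} not-both with x ≡ᵇ u in e
... | true  = ≡ᵇ-≢ (λ y≡v → not-both (≡ᵇ-≡ e , y≡v))
... | false = refl

-- Composing with sᵢ a reorders only the pair {a, a+1}, and (a, a+1) is no inversion of g.
inversion-pair-sᵢ : ∀ (g : ℕ → ℕ) a → g a < g (suc a) → ∀ x y →
  ind ((sᵢ a x <ᵇ sᵢ a y) ∧ (g y <ᵇ g x)) ≡ ind ((x <ᵇ y) ∧ (g y <ᵇ g x)) + ind ((x ≡ᵇ suc a) ∧ (y ≡ᵇ a))
inversion-pair-sᵢ g a ga x y with (x ≟ suc a) ×-dec (y ≟ a) | (x ≟ a) ×-dec (y ≟ suc a)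
... | yes (refl , refl) | _
  rewrite sᵢ-right a | sᵢ-left a | <ᵇ-< (n<1+n a) | <ᵇ-< ga | <ᵇ-≥ (n≤1+n a) | ≡ᵇ-refl a = refl
... | no _ | yes (refl , refl)
  rewrite sᵢ-right a | sᵢ-left a | <ᵇ-≥ (n≤1+n a) | <ᵇ-≥ (<⇒≤ ga) | ≡ᵇ-≢ (1+n≢n {a} ∘ sym) | <ᵇ-< (n<1+n a) = refl
... | no desc | no asc = begin
  ind ((sᵢ a x <ᵇ sᵢ a y) ∧ B)    ≡⟨ cong (λ b → ind (b ∧ B)) (sᵢ-<ᵇ a x y asc (desc ∘ swap)) ⟩
  ind ((x <ᵇ y) ∧ B)              ≡⟨ +-identityʳ _ ⟨
  ind ((x <ᵇ y) ∧ B) + ind false  ≡⟨ cong (λ d → ind ((x <ᵇ y) ∧ B) + ind d) (≡ᵇ-∧-false desc) ⟨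
  ind ((x <ᵇ y) ∧ B) + ind ((x ≡ᵇ suc a) ∧ (y ≡ᵇ a)) ∎
  where
  B : Bool
  B = g y <ᵇ g x

inversions-∘sᵢ : ∀ n (g : ℕ → ℕ) a → 1 ≤ a → suc a ≤ n → g a < g (suc a) →
                 inversions n (g ∘ sᵢ a) ≡ suc (inversions n g)
inversions-∘sᵢ n g a 1≤a a<n ga = begin
  inversions n (g ∘ sᵢ a)
    ≡⟨ sumBy-cong reindex-inner L ⟩
  sumBy (H ∘ sᵢ a) L
    ≡⟨ sumBy-sᵢ H 1≤a a<n ⟩
  sumBy H L
    ≡⟨ sumBy-cong (λ x → trans (sumBy-cong (inversion-pair-sᵢ g a ga x) L) (sumBy-+ L)) L ⟩
  sumBy (λ x → sumBy (λ y → ind ((x <ᵇ y) ∧ (g y <ᵇ g x))) L + sumBy (λ y → ind ((x ≡ᵇ suc a) ∧ (y ≡ᵇ a))) L) L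
    ≡⟨ sumBy-+ L ⟩
  inversions n g + sumBy (λ x → sumBy (λ y → ind ((x ≡ᵇ suc a) ∧ (y ≡ᵇ a))) L) L
    ≡⟨ cong (inversions n g +_) (trans (sumBy-cong column L) (sumBy-indicator (s≤s z≤n) a<n)) ⟩
  inversions n g + 1
    ≡⟨ +-comm _ 1 ⟩
  suc (inversions n g) ∎
  where
  L : List ℕ
  L = range 1 n
  H : ℕ → ℕ
  H x = sumBy (λ y → ind ((sᵢ a x <ᵇ sᵢ a y) ∧ (g y <ᵇ g x))) L
  reindex-inner : ∀ x → sumBy (λ y → ind ((x <ᵇ y) ∧ (g (sᵢ a y) <ᵇ g (sᵢ a x)))) L ≡ H (sᵢ a x)
  reindex-inner x = begin
    sumBy (λ y → ind ((x <ᵇ y) ∧ (g (sᵢ a y) <ᵇ g (sᵢ a x)))) L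
      ≡⟨ sumBy-cong (λ y → cong (λ z → ind ((z <ᵇ y) ∧ (g (sᵢ a y) <ᵇ g (sᵢ a x)))) (sym (sᵢ-involutive a x))) L ⟩
    sumBy (λ y → ind ((sᵢ a (sᵢ a x) <ᵇ y) ∧ (g (sᵢ a y) <ᵇ g (sᵢ a x)))) L
      ≡⟨ sumBy-cong (λ y → cong (λ z → ind ((sᵢ a (sᵢ a x) <ᵇ z) ∧ (g (sᵢ a y) <ᵇ g (sᵢ a x)))) (sym (sᵢ-involutive a y))) L ⟩
    sumBy (λ y → ind ((sᵢ a (sᵢ a x) <ᵇ sᵢ a (sᵢ a y)) ∧ (g (sᵢ a y) <ᵇ g (sᵢ a x)))) L
      ≡⟨ sumBy-sᵢ (λ y → ind ((sᵢ a (sᵢ a x) <ᵇ sᵢ a y) ∧ (g y <ᵇ g (sᵢ a x)))) 1≤a a<n ⟩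
    H (sᵢ a x) ∎
  column : ∀ x → sumBy (λ y → ind ((x ≡ᵇ suc a) ∧ (y ≡ᵇ a))) L ≡ ind (x ≡ᵇ suc a)
  column x with x ≡ᵇ suc a
  ... | true  = sumBy-indicator 1≤a (≤-trans (n≤1+n a) a<n)
  ... | false = sumBy-zero (λ _ → refl) L

sum-tabulate : ∀ m (f : Fin m → ℕ) (g : ℕ → ℕ) s → (∀ i → f i ≡ g (s + toℕ i)) →
               sum (tabulate f) ≡ sumBy g (range s m)
sum-tabulate zero    f g s f≗ = refl
sum-tabulate (suc m) f g s f≗ =
  cong₂ _+_ (trans (f≗ Fin.zero) (cong g (+-identityʳ s)))
            (sum-tabulate m (f ∘ Fin.suc) g (suc s) (λ i → trans (f≗ (Fin.suc i)) (cong g (+-suc s (toℕ i)))))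

countB-sum : ∀ {A : Set} (p : A → Bool) xs → countB p xs ≡ sum (map (ind ∘ p) xs)
countB-sum p []       = refl
countB-sum p (x ∷ xs) with p x
... | true  = cong suc (countB-sum p xs)
... | false = countB-sum p xs

invCount≡inversions : ∀ n (v : Permutation′ n) (g : ℕ → ℕ) →
                      (∀ x → g (suc (toℕ x)) ≡ suc (toℕ (v ⟨$⟩ʳ x))) → invCount v ≡ inversions n g
invCount≡inversions n v g g≗v =
  trans (cong sum (map-tabulate id row)) (sum-tabulate n row _ 1 row≗)
  where
  row : Fin n → ℕ
  row x = countB (λ y → (toℕ x <ᵇ toℕ y) ∧ (toℕ (v ⟨$⟩ʳ y) <ᵇ toℕ (v ⟨$⟩ʳ x))) (allFin n)
  row≗ : ∀ x → row x ≡ sumBy (λ y → ind ((suc (toℕ x) <ᵇ y) ∧ (g y <ᵇ g (suc (toℕ x))))) (range 1 n)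
  row≗ x = trans (countB-sum _ (allFin n)) (trans (cong sum (map-tabulate {n = n} id _))
    (sum-tabulate n _ _ 1 (λ y → cong₂ (λ u u′ → ind ((toℕ x <ᵇ toℕ y) ∧ (u <ᵇ u′))) (sym (g≗v y)) (sym (g≗v x)))))

letter : ℕ → ℕ → ℕ
letter r j = r + j ∸ 1

letter-suc : ∀ r a → letter r (suc a) ≡ r + a
letter-suc r a = cong (_∸ 1) (+-suc r a)

rowWord : Grid → ℕ → ℕ → ℕ → List ℕ
rowWord G r a m = map (letter r) (filterB (G r) (range (suc a) m))

phi≡rowWord : ∀ n G r → phi n G r ≡ rowWord G r 0 n
phi≡rowWord n G r = cong (λ l → map (letter r) (filterB (G r) l)) (oneTo≡range n)

module _ (G : Grid) (r : ℕ) where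

  rowWord-++ : ∀ a m k → rowWord G r a (m + k) ≡ rowWord G r a m ++ rowWord G r (a + m) k
  rowWord-++ a m k = begin
    map (letter r) (filterB (G r) (range (suc a) (m + k)))
      ≡⟨ cong (map (letter r) ∘ filterB (G r)) (range-++ (suc a) m k) ⟩
    map (letter r) (filterB (G r) (range (suc a) m ++ range (suc a + m) k))
      ≡⟨ cong (map (letter r)) (filterB-++ (G r) (range (suc a) m) _) ⟩
    map (letter r) (filterB (G r) (range (suc a) m) ++ filterB (G r) (range (suc a + m) k))
      ≡⟨ map-++ (letter r) (filterB (G r) (range (suc a) m)) _ ⟩
    rowWord G r a m ++ rowWord G r (a + m) k ∎

  rowWord-suc : ∀ a m → rowWord G r a (suc m)
              ≡ (if G r (suc a) then (r + a) ∷ rowWord G r (suc a) m else rowWord G r (suc a) m)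
  rowWord-suc a m with G r (suc a)
  ... | true  = cong (_∷ rowWord G r (suc a) m) (letter-suc r a)
  ... | false = refl

  rowWord-cross : ∀ a → G r (suc a) ≡ true → rowWord G r a 1 ≡ (r + a) ∷ []
  rowWord-cross a e rewrite rowWord-suc a 0 | e = refl

  rowWord-elbow : ∀ a → G r (suc a) ≡ false → rowWord G r a 1 ≡ []
  rowWord-elbow a e rewrite rowWord-suc a 0 | e = refl

  rowWord-snoc : ∀ c → rowWord G r 0 (suc c) ≡ rowWord G r 0 c ++ rowWord G r c 1
  rowWord-snoc c = trans (cong (rowWord G r 0) (+-comm 1 c)) (rowWord-++ 0 c 1)

  rowWord-snoc-cross : ∀ c → G r (suc c) ≡ true → rowWord G r 0 (suc c) ≡ rowWord G r 0 c ++ (r + c) ∷ []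
  rowWord-snoc-cross c e = trans (rowWord-snoc c) (cong (rowWord G r 0 c ++_) (rowWord-cross c e))

  rowWord-snoc-elbow : ∀ c → G r (suc c) ≡ false → rowWord G r 0 (suc c) ≡ rowWord G r 0 c
  rowWord-snoc-elbow c e = trans (rowWord-snoc c) (trans (cong (rowWord G r 0 c ++_) (rowWord-elbow c e)) (++-identityʳ _))

  rowWord-bounds : ∀ a m → All (λ x → r + a ≤ x × x < r + a + m) (rowWord G r a m)
  rowWord-bounds a m = All.map⁺ (All-filterB (G r) (All.map bound (range-bounds (suc a) m)))
    where
    bound : ∀ {j} → suc a ≤ j × j < suc a + m → r + a ≤ letter r j × letter r j < r + a + m
    bound {suc j} (s≤s a≤j , s≤s j<) rewrite letter-suc r j =
      +-monoʳ-≤ r a≤j , subst (r + j <_) (sym (+-assoc r a m)) (+-monoʳ-< r j<)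

  rowWord-fixes-right : ∀ c → actWord (rowWord G r 0 c) (suc (r + c)) ≡ suc (r + c)
  rowWord-fixes-right c = actWord-apart _
    (All.map (λ {x} p → inj₂ (s≤s (subst (x <_) (cong (_+ c) (+-identityʳ r)) (proj₂ p)))) (rowWord-bounds 0 c))

  rowWord-fixes-left : ∀ a m {y} → y < r + a → actWord (rowWord G r a m) y ≡ y
  rowWord-fixes-left a m y< = actWord-apart _ (All.map (λ q → inj₁ (<-≤-trans y< (proj₁ q))) (rowWord-bounds a m))

  rowWord-crosses : ∀ a m → All (λ x → Σ ℕ λ j → G r j ≡ true × a < j × j ≤ a + m × x ≡ letter r j) (rowWord G r a m)
  rowWord-crosses a m = All.map⁺ (go (range (suc a) m) (range-bounds (suc a) m))
    where
    go : ∀ js → All (λ j → suc a ≤ j × j < suc a + m) js →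
         All (λ j → Σ ℕ λ j′ → G r j′ ≡ true × a < j′ × j′ ≤ a + m × letter r j ≡ letter r j′) (filterB (G r) js)
    go []       []               = []
    go (j ∷ js) ((a<j , j<) ∷ ps) with G r j in e
    ... | true  = (j , e , a<j , ≤-pred j< , refl) ∷ go js ps
    ... | false = go js ps

  rowWord-cong : ∀ {G′ : Grid} a m → (∀ j → a < j → j ≤ a + m → G r j ≡ G′ r j) → rowWord G r a m ≡ rowWord G′ r a m
  rowWord-cong a m G≗ = cong (map (letter r))
    (filterB-cong (All.map (λ { (a<j , j<) → G≗ _ a<j (≤-pred j<) }) (range-bounds (suc a) m)))

  rowWord-empty : ∀ a m → (∀ j → a < j → j ≤ a + m → G r j ≡ false) → rowWord G r a m ≡ []
  rowWord-empty a m none = cong (map (letter r))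
    (filterB-none (All.map (λ { (a<j , j<) → none _ a<j (≤-pred j<) }) (range-bounds (suc a) m)))

  rowWord-full : ∀ a m → (∀ j → a < j → j ≤ a + m → G r j ≡ true) → rowWord G r a m ≡ range (r + a) m
  rowWord-full a zero    all = refl
  rowWord-full a (suc m) all = begin
    rowWord G r a (suc m)
      ≡⟨ rowWord-suc a m ⟩
    (if G r (suc a) then (r + a) ∷ rowWord G r (suc a) m else rowWord G r (suc a) m)
      ≡⟨ cong (λ b → if b then (r + a) ∷ rowWord G r (suc a) m else rowWord G r (suc a) m)
              (all (suc a) ≤-refl (subst (suc a ≤_) (sym (+-suc a m)) (s≤s (m≤m+n a m)))) ⟩
    (r + a) ∷ rowWord G r (suc a) m
      ≡⟨ cong ((r + a) ∷_) (rowWord-full (suc a) m (λ j a<j j≤ → all j (<⇒≤ a<j) (subst (j ≤_) (sym (+-suc a m)) j≤))) ⟩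
    (r + a) ∷ range (r + suc a) m
      ≡⟨ cong (λ z → (r + a) ∷ range z m) (+-suc r a) ⟩
    range (r + a) (suc m) ∎

  rowWord-sorted : ∀ a m → AllPairs _<_ (rowWord G r a m)
  rowWord-sorted a zero    = []
  rowWord-sorted a (suc m) rewrite rowWord-suc a m with G r (suc a)
  ... | true  = All.map (λ p → <-≤-trans (+-monoʳ-< r (n<1+n a)) (proj₁ p)) (rowWord-bounds (suc a) m)
              ∷ rowWord-sorted (suc a) m
  ... | false = rowWord-sorted (suc a) m

phi-block : ∀ n G k → Linked _<_ (phi n G k) × HeadGeq k (phi n G k)
phi-block n G k rewrite phi≡rowWord n G k =
  AllPairs⇒Linked (rowWord-sorted G k 0 n) , head≥ (rowWord-bounds G k 0 n)
  where
  head≥ : ∀ {xs} → All (λ x → k + 0 ≤ x × x < k + 0 + n) xs → HeadGeq k xs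
  head≥ []            = tt
  head≥ ((k≤x , _) ∷ _) = subst (_≤ _) (+-identityʳ k) k≤x

crossCols≡filter : ∀ n G r → crossCols n G r ≡ filterB (G r) (range 1 n)
crossCols≡filter n G r = cong (filterB (G r)) (oneTo≡range n)

crossCols-∈⁺ : ∀ n G r {z} → G r z ≡ true → 1 ≤ z → z ≤ n → z ∈ crossCols n G r
crossCols-∈⁺ n G r e 1≤z z≤bound =
  subst (_ ∈_) (sym (crossCols≡filter n G r)) (∈-filterB⁺ (G r) (∈-range⁺ 1 n 1≤z (s≤s z≤bound)) e)

crossCols-∈⁻ : ∀ n G r {z} → z ∈ crossCols n G r → G r z ≡ true × 1 ≤ z × z ≤ n
crossCols-∈⁻ n G r z∈
  with z∈range , e ← ∈-filterB⁻ (G r) (range 1 n) (subst (_ ∈_) (crossCols≡filter n G r) z∈)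
  with 1≤z , z<1+n ← All.lookup (range-bounds 1 n) z∈range = e , 1≤z , ≤-pred z<1+n

crossCols-sorted : ∀ n G r → AllPairs _<_ (crossCols n G r)
crossCols-sorted n G r rewrite crossCols≡filter n G r = sorted 1 n
  where
  sorted : ∀ s m → AllPairs _<_ (filterB (G r) (range s m))
  sorted s zero    = []
  sorted s (suc m) with G r s
  ... | true  = All-filterB (G r) (All.map proj₁ (range-bounds (suc s) m)) ∷ sorted (suc s) m
  ... | false = sorted (suc s) m

-- The word of a pipe dream and the labels of its pipes

module PipeWord (n : ℕ) (D : Grid) (pd : IsPipeDream n D) where

  row : ℕ → List ℕ
  row k = rowWord D k 0 n

  band : ℕ → ℕ → List ℕ
  band r zero    = []
  band r (suc d) = row (r + suc d) ++ band r d

  -- the rows strictly below row r, read from the bottom up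
  below : ℕ → List ℕ
  below r = band r (n ∸ r)

  band-suc : ∀ r d → band r (suc d) ≡ band (suc r) d ++ row (suc r)
  band-suc r zero    = trans (++-identityʳ _) (cong row (+-comm r 1))
  band-suc r (suc d) = trans (cong₂ _++_ (cong row (+-suc r (suc d))) (band-suc r d))
                             (sym (++-assoc (row (suc r + suc d)) (band (suc r) d) (row (suc r))))

  no-cross-outside : ∀ r j → n < r + j → D r j ≡ false
  no-cross-outside r j n<r+j with D r j in e
  ... | true  = ⊥-elim (<⇒≱ n<r+j (proj₂ (proj₂ (pd r j e))))
  ... | false = refl

  no-cross-row₀ : ∀ j → D 0 j ≡ false
  no-cross-row₀ j with D 0 j in e
  ... | true  = ⊥-elim (<-irrefl refl (proj₁ (pd 0 j e)))
  ... | false = refl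

  no-cross-column₀ : ∀ r → D r 0 ≡ false
  no-cross-column₀ r with D r 0 in e
  ... | true  = ⊥-elim (<-irrefl refl (proj₁ (proj₂ (pd r 0 e))))
  ... | false = refl

  row-empty : ∀ k → n ≤ k → row k ≡ []
  row-empty k n≤k = rowWord-empty D k 0 n
    (λ j 0<j _ → no-cross-outside k j (≤-trans (s≤s n≤k) (subst (_≤ k + j) (+-comm k 1) (+-monoʳ-≤ k 0<j))))

  below-suc : ∀ r → below r ≡ below (suc r) ++ row (suc r)
  below-suc r with r <? n
  ... | yes r<n = trans (cong (band r) (+-∸-assoc 1 r<n)) (band-suc r (n ∸ suc r))
  ... | no r≮n  = begin
    band r (n ∸ r)
      ≡⟨ cong (band r) (m≤n⇒m∸n≡0 n≤r) ⟩
    []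
      ≡⟨ cong₂ _++_ (cong (band (suc r)) (m≤n⇒m∸n≡0 (m≤n⇒m≤1+n n≤r))) (row-empty (suc r) (m≤n⇒m≤1+n n≤r)) ⟨
    band (suc r) (n ∸ suc r) ++ row (suc r) ∎
    where
    n≤r : n ≤ r
    n≤r = ≮⇒≥ r≮n

  row-≥ : ∀ k → All (k ≤_) (row k)
  row-≥ k = All.map (λ p → subst (_≤ _) (+-identityʳ k) (proj₁ p)) (rowWord-bounds D k 0 n)

  band-≥ : ∀ r d → All (suc r ≤_) (band r d)
  band-≥ r zero    = []
  band-≥ r (suc d) = All.++⁺ (All.map (≤-trans (subst (_≤ r + suc d) (+-comm r 1) (+-monoʳ-≤ r (s≤s z≤n)))) (row-≥ (r + suc d)))
                             (band-≥ r d)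

  rowWord-< : ∀ k a m → All (λ x → suc x ≤ n) (rowWord D k a m)
  rowWord-< k a m = All.map bound (rowWord-crosses D k a m)
    where
    bound : ∀ {x} → Σ ℕ (λ j → D k j ≡ true × a < j × j ≤ a + m × x ≡ letter k j) → suc x ≤ n
    bound (suc j , e , _ , _ , refl) rewrite letter-suc k j = subst (_≤ n) (+-suc k j) (proj₂ (proj₂ (pd k (suc j) e)))

  band-< : ∀ r d → All (λ x → suc x ≤ n) (band r d)
  band-< r zero    = []
  band-< r (suc d) = All.++⁺ (rowWord-< (r + suc d) 0 n) (band-< r d)

  below₀≡factWord : below 0 ≡ factWord n (phi n D)
  below₀≡factWord = top-row-empty n refl
    where
    band₀ : ∀ m → band 0 m ≡ concat (map (phi n D) (map suc (downFrom m)))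
    band₀ zero    = refl
    band₀ (suc m) = cong₂ _++_ (sym (phi≡rowWord n D (suc m))) (band₀ m)
    top-row-empty : ∀ m → m ≡ n → band 0 m ≡ concat (map (phi n D) (map suc (downFrom (m ∸ 1))))
    top-row-empty zero    _   = refl
    top-row-empty (suc m) m≡n = trans (cong (_++ band 0 m) (row-empty (suc m) (≤-reflexive (sym m≡n)))) (band₀ m)

  -- The word of the boxes read before (r, c + 1) sends r + c and r + c + 1 to the entry
  -- rows of the pipes through the left and the bottom edge of that box.
  prefixAct : ℕ → ℕ → ℕ → ℕ
  prefixAct r c = actWord (below r) ∘ actWord (rowWord D r 0 c)

  leftLabel : ℕ → ℕ → ℕ
  leftLabel r c = prefixAct r c (r + c)

  bottomLabel : ℕ → ℕ → ℕ
  bottomLabel r c = actWord (below r) (suc (r + c))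

  topLabel : ℕ → ℕ → ℕ
  topLabel r c = actWord (below r) (actWord (row r) (r + c))

  prefixAct-cross : ∀ r c y → D r (suc c) ≡ true → prefixAct r (suc c) y ≡ prefixAct r c (sᵢ (r + c) y)
  prefixAct-cross r c y e = cong (actWord (below r))
    (trans (cong (λ l → actWord l y) (rowWord-snoc-cross D r c e)) (actWord-++ (rowWord D r 0 c) _ y))

  prefixAct-elbow : ∀ r c y → D r (suc c) ≡ false → prefixAct r (suc c) y ≡ prefixAct r c y
  prefixAct-elbow r c y e = cong (λ l → actWord (below r) (actWord l y)) (rowWord-snoc-elbow D r c e)

  prefixAct-row : ∀ r y → prefixAct r 0 y ≡ prefixAct (suc r) n y
  prefixAct-row r y = trans (cong (λ l → actWord l y) (below-suc r)) (actWord-++ (below (suc r)) (row (suc r)) y)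

  prefixAct-bottom : ∀ r c → prefixAct r c (suc (r + c)) ≡ bottomLabel r c
  prefixAct-bottom r c = cong (actWord (below r)) (rowWord-fixes-right D r c)

  leftLabel-start : ∀ r → leftLabel r 0 ≡ r
  leftLabel-start r = trans (cong (actWord (below r)) (+-identityʳ r))
    (actWord-apart (below r) (All.map inj₁ (band-≥ r (n ∸ r))))

  leftLabel-cross : ∀ r c → D r (suc c) ≡ true → leftLabel r (suc c) ≡ leftLabel r c
  leftLabel-cross r c e = begin
    prefixAct r (suc c) (r + suc c)       ≡⟨ prefixAct-cross r c _ e ⟩
    prefixAct r c (sᵢ (r + c) (r + suc c)) ≡⟨ cong (prefixAct r c ∘ sᵢ (r + c)) (+-suc r c) ⟩
    prefixAct r c (sᵢ (r + c) (suc (r + c))) ≡⟨ cong (prefixAct r c) (sᵢ-right (r + c)) ⟩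
    prefixAct r c (r + c)                 ∎

  leftLabel-elbow : ∀ r c → D r (suc c) ≡ false → leftLabel r (suc c) ≡ bottomLabel r c
  leftLabel-elbow r c e = begin
    prefixAct r (suc c) (r + suc c)    ≡⟨ prefixAct-elbow r c _ e ⟩
    prefixAct r c (r + suc c)          ≡⟨ cong (prefixAct r c) (+-suc r c) ⟩
    prefixAct r c (suc (r + c))        ≡⟨ prefixAct-bottom r c ⟩
    bottomLabel r c                    ∎

  topLabel-elbow : ∀ r c → D r (suc c) ≡ false → topLabel r c ≡ leftLabel r c
  topLabel-elbow r c e = cong (actWord (below r)) (rest (≤-total c n))
    where
    rest : c ≤ n ⊎ n ≤ c → actWord (row r) (r + c) ≡ actWord (rowWord D r 0 c) (r + c)
    rest (inj₁ c≤n) with k , refl ← m≤n⇒∃[o]m+o≡n c≤n = begin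
      actWord (rowWord D r 0 (c + k)) (r + c)
        ≡⟨ cong (λ l → actWord l (r + c)) (rowWord-++ D r 0 c k) ⟩
      actWord (rowWord D r 0 c ++ rowWord D r c k) (r + c)
        ≡⟨ actWord-++ (rowWord D r 0 c) _ _ ⟩
      actWord (rowWord D r 0 c) (actWord (rowWord D r c k) (r + c))
        ≡⟨ cong (actWord (rowWord D r 0 c)) (skip k) ⟩
      actWord (rowWord D r 0 c) (r + c) ∎
      where
      skip : ∀ k → actWord (rowWord D r c k) (r + c) ≡ r + c
      skip zero    = refl
      skip (suc k) rewrite rowWord-suc D r c k | e = rowWord-fixes-left D r (suc c) k (+-monoʳ-< r ≤-refl)
    rest (inj₂ n≤c) with k , refl ← m≤n⇒∃[o]m+o≡n n≤c = cong (λ l → actWord l (r + (n + k))) (sym (begin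
      rowWord D r 0 (n + k)          ≡⟨ rowWord-++ D r 0 n k ⟩
      row r ++ rowWord D r n k
        ≡⟨ cong (row r ++_) (rowWord-empty D r n k (λ j n<j _ → no-cross-outside r j (<-≤-trans n<j (m≤n+m j r)))) ⟩
      row r ++ []                    ≡⟨ ++-identityʳ _ ⟩
      row r                          ∎))

  topLabel-cross : ∀ r c → D r (suc c) ≡ true → topLabel r c ≡ bottomLabel r c
  topLabel-cross r c e with k , r+c+k≡n ← m≤n⇒∃[o]m+o≡n (≤-trans (m≤n+m (suc c) r) (proj₂ (proj₂ (pd r (suc c) e)))) =
    cong (actWord (below r)) (begin
      actWord (row r) (r + c)
        ≡⟨ cong (λ l → actWord l (r + c))
                (trans (cong (rowWord D r 0) (sym (trans (+-suc c k) r+c+k≡n))) (rowWord-++ D r 0 c (suc k))) ⟩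
      actWord (rowWord D r 0 c ++ rowWord D r c (suc k)) (r + c)
        ≡⟨ actWord-++ (rowWord D r 0 c) _ _ ⟩
      actWord (rowWord D r 0 c) (actWord (rowWord D r c (suc k)) (r + c))
        ≡⟨ cong (λ l → actWord (rowWord D r 0 c) (actWord l (r + c))) (trans (rowWord-suc D r c k) (if-true e)) ⟩
      actWord (rowWord D r 0 c) (sᵢ (r + c) (actWord (rowWord D r (suc c) k) (r + c)))
        ≡⟨ cong (actWord (rowWord D r 0 c) ∘ sᵢ (r + c)) (rowWord-fixes-left D r (suc c) k (+-monoʳ-< r ≤-refl)) ⟩
      actWord (rowWord D r 0 c) (sᵢ (r + c) (r + c))
        ≡⟨ cong (actWord (rowWord D r 0 c)) (sᵢ-left (r + c)) ⟩
      actWord (rowWord D r 0 c) (suc (r + c))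
        ≡⟨ rowWord-fixes-right D r c ⟩
      suc (r + c) ∎)

  topLabel-suc : ∀ r c → topLabel (suc r) c ≡ bottomLabel r c
  topLabel-suc r c = sym (trans (cong (λ l → actWord l (suc (r + c))) (below-suc r)) (actWord-++ (below (suc r)) (row (suc r)) _))

  label : Dir → ℕ → ℕ → ℕ
  label fromLeft   = leftLabel
  label fromBottom = bottomLabel

  walk-label : ∀ f r c d {e} → proj₂ (walk D f (suc r) (suc c) d) ≡ just e → actWord (below 0) e ≡ label d (suc r) c
  walk-label (suc f) r c fromLeft h with D (suc r) (suc c) in eq
  walk-label (suc f) r c fromLeft h | true =
    trans (walk-label f r (suc c) fromLeft h) (leftLabel-cross (suc r) c eq)
  walk-label (suc f) zero c fromLeft refl | false =
    trans (sym (topLabel-suc 0 c)) (topLabel-elbow 1 c eq)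
  walk-label (suc f) (suc r) c fromLeft h | false =
    trans (walk-label f r c fromBottom h) (trans (sym (topLabel-suc (suc r) c)) (topLabel-elbow (suc (suc r)) c eq))
  walk-label (suc f) r c fromBottom h with D (suc r) (suc c) in eq
  walk-label (suc f) r c fromBottom h | false =
    trans (walk-label f r (suc c) fromLeft h) (leftLabel-elbow (suc r) c eq)
  walk-label (suc f) zero c fromBottom refl | true =
    trans (sym (topLabel-suc 0 c)) (topLabel-cross 1 c eq)
  walk-label (suc f) (suc r) c fromBottom h | true =
    trans (walk-label f r c fromBottom h) (trans (sym (topLabel-suc (suc r) c)) (topLabel-cross (suc (suc r)) c eq))

  pipeExit-label : ∀ k {e} → pipeExit n D (suc k) ≡ just e → actWord (below 0) e ≡ suc k
  pipeExit-label k h = trans (walk-label (2 * n + 2) k 0 fromLeft h) (leftLabel-start (suc k))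

  letters-in-range : All (λ a → 1 ≤ a × suc a ≤ n) (below 0)
  letters-in-range = All.zip (band-≥ 0 n , band-< 0 n)

  phi-outside : ∀ k → (k ≡ 0 ⊎ n ≤ k) → phi n D k ≡ []
  phi-outside k (inj₁ refl) = trans (phi≡rowWord n D 0) (rowWord-empty D 0 0 n (λ j _ _ → no-cross-row₀ j))
  phi-outside k (inj₂ n≤k)  = trans (phi≡rowWord n D k) (row-empty k n≤k)

  InRFC-phi : ∀ {v} → length (below 0) ≡ invCount v →
              (∀ x → actWord (below 0) (suc (toℕ x)) ≡ suc (toℕ (v ⟨$⟩ʳ x))) → InRFC n v (phi n D)
  InRFC-phi {v} len≡ act≡ =
    phi-outside , (λ k _ _ → phi-block n D k) ,
    subst (IsReducedWord n v) below₀≡factWord (letters-in-range , len≡ , act≡)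

  below₀-split : ∀ r → below 0 ≡ below r ++ band 0 r
  below₀-split zero    = sym (++-identityʳ _)
  below₀-split (suc r) = trans (below₀-split r)
    (trans (cong (_++ band 0 r) (below-suc r)) (++-assoc (below (suc r)) (row (suc r)) (band 0 r)))

  leftLabel-run : ∀ r a m → (∀ z → a < z → z ≤ a + m → D r z ≡ true) → leftLabel r (a + m) ≡ leftLabel r a
  leftLabel-run r a zero    _       = cong (leftLabel r) (+-identityʳ a)
  leftLabel-run r a (suc m) crosses = begin
    leftLabel r (a + suc m)   ≡⟨ cong (leftLabel r) (+-suc a m) ⟩
    leftLabel r (suc (a + m))
      ≡⟨ leftLabel-cross r (a + m) (crosses (suc (a + m)) (s≤s (m≤m+n a m)) (≤-reflexive (sym (+-suc a m)))) ⟩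
    leftLabel r (a + m)       ≡⟨ leftLabel-run r a m (λ z a<z z≤ → crosses z a<z (≤-trans z≤ (+-monoʳ-≤ a (n≤1+n m)))) ⟩
    leftLabel r a             ∎

module PipePaths (n : ℕ) (D : Grid) (pd : IsPipeDream n D) where
  open PipeWord n D pd

  -- (r , c , d): a pipe enters the box (r, c + 1) through the edge d
  Entry : Set
  Entry = ℕ × ℕ × Dir

  data Step : Entry → Entry → Set where
    cross-left    : ∀ r c → D r (suc c) ≡ true → Step (r , c , fromLeft) (r , suc c , fromLeft)
    elbow-left    : ∀ r c → D (2 + r) (suc c) ≡ false → Step (2 + r , c , fromLeft) (suc r , c , fromBottom)
    cross-bottom  : ∀ r c → D (2 + r) (suc c) ≡ true → Step (2 + r , c , fromBottom) (suc r , c , fromBottom)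
    elbow-bottom  : ∀ r c → D r (suc c) ≡ false → Step (r , c , fromBottom) (r , suc c , fromLeft)

  data Reaches (e₀ : Entry) : ℕ → Entry → Set where
    start : Reaches e₀ 0 e₀
    step : ∀ {k e e′} → Reaches e₀ k e → Step e e′ → Reaches e₀ (suc k) e′

  boxesFrom : ℕ → Entry → List (ℕ × ℕ)
  boxesFrom f (r , c , d) = proj₁ (walk D f r (suc c) d)

  boxesFrom-step : ∀ {e e′} → Step e e′ → ∀ f {b} → b ∈ boxesFrom f e′ → b ∈ boxesFrom (suc f) e
  boxesFrom-step (cross-left r c e)   f b∈ with D r (suc c)       | e
  ... | true  | _ = there b∈
  boxesFrom-step (elbow-left r c e)   f b∈ with D (2 + r) (suc c) | e
  ... | false | _ = there b∈
  boxesFrom-step (cross-bottom r c e) f b∈ with D (2 + r) (suc c) | e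
  ... | true  | _ = there b∈
  boxesFrom-step (elbow-bottom r c e) f b∈ with D r (suc c)       | e
  ... | false | _ = there b∈

  boxesFrom-head : ∀ f r c d → (r , suc c) ∈ boxesFrom (suc f) (r , c , d)
  boxesFrom-head f r c fromLeft with D r (suc c)
  ... | true = here refl
  boxesFrom-head f zero          c fromLeft | false = here refl
  boxesFrom-head f (suc zero)    c fromLeft | false = here refl
  boxesFrom-head f (suc (suc r)) c fromLeft | false = here refl
  boxesFrom-head f r c fromBottom with D r (suc c)
  ... | false = here refl
  boxesFrom-head f zero          c fromBottom | true = here refl
  boxesFrom-head f (suc zero)    c fromBottom | true = here refl
  boxesFrom-head f (suc (suc r)) c fromBottom | true = here refl

  boxesFrom-reaches : ∀ {e₀ k e} → Reaches e₀ k e → ∀ f {b} → b ∈ boxesFrom f e → b ∈ boxesFrom (k + f) e₀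
  boxesFrom-reaches start f b∈ = b∈
  boxesFrom-reaches {e₀} (step {k} R st) f {b} b∈ =
    subst (λ z → b ∈ boxesFrom z e₀) (+-suc k f) (boxesFrom-reaches R (suc f) (boxesFrom-step st f b∈))

  bottomLabel-> : ∀ r c → suc r < bottomLabel (suc r) c
  bottomLabel-> r c = actWord-≥ (below (suc r)) (band-≥ (suc r) (n ∸ suc r)) (s≤s (m≤m+n (suc r) c))

  one-row-up : ∀ {r x K} c → suc r < x → c + (x ∸ suc r) ≡ suc K → c + (x ∸ (2 + r)) ≡ K
  one-row-up c r<x K≡ = suc-injective (trans (sym (+-suc c _)) (trans (cong (c +_) (sym (+-∸-assoc 1 r<x))) K≡))

  -- The pipe labelled x reaches the entry (r+1, c, d) after c + (x - r - 1) steps: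
  -- each step either moves one column right or one row up.
  reaches-from-label : ∀ K r c d {x} → label d (suc r) c ≡ x → c + (x ∸ suc r) ≡ K →
                       Reaches (x , 0 , fromLeft) K (suc r , c , d)
  reaches-from-label zero r zero fromLeft refl _ rewrite leftLabel-start (suc r) = start
  reaches-from-label zero r c fromBottom refl K≡ =
    ⊥-elim (<⇒≱ (bottomLabel-> r c) (m∸n≡0⇒m≤n (m+n≡0⇒n≡0 c K≡)))
  reaches-from-label (suc K) r zero fromLeft refl K≡ rewrite leftLabel-start (suc r) | n∸n≡0 r = ⊥-elim (0≢1+n K≡)
  reaches-from-label (suc K) r (suc c) fromLeft x≡ K≡ with D (suc r) (suc c) in e
  ... | true  = step (reaches-from-label K r c fromLeft (trans (sym (leftLabel-cross (suc r) c e)) x≡) (suc-injective K≡))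
                     (cross-left (suc r) c e)
  ... | false = step (reaches-from-label K r c fromBottom (trans (sym (leftLabel-elbow (suc r) c e)) x≡) (suc-injective K≡))
                     (elbow-bottom (suc r) c e)
  reaches-from-label (suc K) r c fromBottom x≡ K≡ with D (2 + r) (suc c) in e
  ... | false = step (reaches-from-label K (suc r) c fromLeft
                       (trans (sym (topLabel-elbow (2 + r) c e)) (trans (topLabel-suc (suc r) c) x≡))
                       (one-row-up c (subst (suc r <_) x≡ (bottomLabel-> r c)) K≡))
                     (elbow-left r c e)
  ... | true  = step (reaches-from-label K (suc r) c fromBottom
                       (trans (sym (topLabel-cross (2 + r) c e)) (trans (topLabel-suc (suc r) c) x≡))
                       (one-row-up c (subst (suc r <_) x≡ (bottomLabel-> r c)) K≡))
                     (cross-bottom r c e)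

  -- the fuel 2n + 2 given to `pipe` suffices to reach every box
  steps<fuel : ∀ {c x} r → c < n → x ≤ n → c + (x ∸ r) < 2 * n + 2
  steps<fuel {c} {x} r c<n x≤n =
    ≤-trans (+-monoʳ-≤ (suc c) (≤-trans (m∸n≤m x r) x≤n))
      (≤-trans (+-monoˡ-≤ n c<n) (≤-trans (≤-reflexive (cong (n +_) (sym (+-identityʳ n)))) (m≤m+n (2 * n) 2)))

  label-on-pipe : ∀ r c d {x} → label d (suc r) c ≡ x → c < n → x ≤ n → (suc r , suc c) ∈ proj₁ (pipe n D x)
  label-on-pipe r c d {x} x≡ c<n x≤n with o , o≡ ← m≤n⇒∃[o]m+o≡n (steps<fuel (suc r) c<n x≤n) =
    subst (λ f → (suc r , suc c) ∈ boxesFrom f (x , 0 , fromLeft)) (trans (+-suc (c + (x ∸ suc r)) o) o≡)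
      (boxesFrom-reaches (reaches-from-label _ r c d x≡ refl) (suc o) (boxesFrom-head o (suc r) c d))

  MeetAt : ℕ → ℕ → ℕ → ℕ → Set
  MeetAt r c p q = (leftLabel r c ≡ p × bottomLabel r c ≡ q) ⊎ (leftLabel r c ≡ q × bottomLabel r c ≡ p)

  CrossBefore : ℕ → ℕ → ℕ → ℕ → Set
  CrossBefore r c p q = Σ ℕ λ r′ → Σ ℕ λ c′ →
    D r′ (suc c′) ≡ true × (r < r′ ⊎ (r′ ≡ r × c′ < c)) × MeetAt r′ c′ p q

  InversionsCrossed : ℕ → ℕ → Set
  InversionsCrossed r c = ∀ {x y} → x < y → prefixAct r c y < prefixAct r c x →
                          CrossBefore r c (prefixAct r c y) (prefixAct r c x)

  crossBefore-suc : ∀ {r c p q} → CrossBefore r c p q → CrossBefore r (suc c) p q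
  crossBefore-suc (r′ , c′ , e , inj₁ r<r′ , m) = r′ , c′ , e , inj₁ r<r′ , m
  crossBefore-suc (r′ , c′ , e , inj₂ (r≡ , c′<c) , m) = r′ , c′ , e , inj₂ (r≡ , m<n⇒m<1+n c′<c) , m

  crossBefore-up : ∀ {r c c′ p q} → CrossBefore (suc r) c′ p q → CrossBefore r c p q
  crossBefore-up (r′ , c″ , e , inj₁ r<r′ , m) = r′ , c″ , e , inj₁ (<-trans (n<1+n _) r<r′) , m
  crossBefore-up (r′ , c″ , e , inj₂ (refl , _) , m) = r′ , c″ , e , inj₁ (n<1+n _) , m

  inversion-transport : ∀ (P : ℕ → ℕ → Set) {f g : ℕ → ℕ} → (∀ z → f z ≡ g z) → ∀ {x y} →
    (g y < g x → P (g y) (g x)) → f y < f x → P (f y) (f x)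
  inversion-transport P f≗g {x} {y} h lt =
    subst₂ P (sym (f≗g y)) (sym (f≗g x)) (h (subst₂ _<_ (f≗g y) (f≗g x) lt))

  inversionsCrossed-suc : ∀ r c → InversionsCrossed r c → InversionsCrossed r (suc c)
  inversionsCrossed-suc r c I {x} {y} x<y with D r (suc c) in e
  ... | false = inversion-transport (CrossBefore r (suc c)) (λ z → prefixAct-elbow r c z e) (crossBefore-suc ∘ I x<y)
  ... | true with sᵢ-< (r + c) x<y
  ...   | inj₁ (refl , refl) = λ _ → r , c , e , inj₂ (refl , ≤-refl) , inj₁ (left≡ , bottom≡)
    where
    left≡ : leftLabel r c ≡ prefixAct r (suc c) (suc (r + c))
    left≡ = sym (trans (prefixAct-cross r c _ e) (cong (prefixAct r c) (sᵢ-right (r + c))))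
    bottom≡ : bottomLabel r c ≡ prefixAct r (suc c) (r + c)
    bottom≡ = sym (trans (prefixAct-cross r c _ e) (trans (cong (prefixAct r c) (sᵢ-left (r + c))) (prefixAct-bottom r c)))
  ...   | inj₂ sx<sy = inversion-transport (CrossBefore r (suc c)) (λ z → prefixAct-cross r c z e) (crossBefore-suc ∘ I sx<sy)

  inversionsCrossed-row : ∀ r → InversionsCrossed r 0 → ∀ c → InversionsCrossed r c
  inversionsCrossed-row r I zero    = I
  inversionsCrossed-row r I (suc c) = inversionsCrossed-suc r c (inversionsCrossed-row r I c)

  inversionsCrossed-bottom : InversionsCrossed n 0
  inversionsCrossed-bottom {x} {y} x<y y>x = ⊥-elim (<-asym x<y (subst₂ _<_ (trivial y) (trivial x) y>x))
    where
    trivial : ∀ z → prefixAct n 0 z ≡ z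
    trivial z = cong (λ k → actWord (band n k) z) (n∸n≡0 n)

  inversionsCrossed-start : ∀ d r → r + d ≡ n → InversionsCrossed r 0
  inversionsCrossed-start zero r r+0≡n rewrite trans (sym (+-identityʳ r)) r+0≡n = inversionsCrossed-bottom
  inversionsCrossed-start (suc d) r r+d≡n x<y =
    inversion-transport (CrossBefore r 0) (prefixAct-row r)
      (crossBefore-up ∘ inversionsCrossed-row (suc r) (inversionsCrossed-start d (suc r) (trans (sym (+-suc r d)) r+d≡n)) n x<y)

  inversionsCrossed : ∀ r c → r ≤ n → InversionsCrossed r c
  inversionsCrossed r c r≤n = inversionsCrossed-row r (inversionsCrossed-start (n ∸ r) r (m+[n∸m]≡n r≤n)) c

  cross-bound : ∀ {r c} → D r (suc c) ≡ true → r + suc c ≤ n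
  cross-bound {r} {c} e = proj₂ (proj₂ (pd r (suc c) e))

  leftLabel-≤ : ∀ r c → r + c ≤ n → leftLabel r c ≤ n
  leftLabel-≤ r c r+c≤n = actWord-≤ (below r) (band-< r (n ∸ r)) (actWord-≤ (rowWord D r 0 c) (rowWord-< r 0 c) r+c≤n)

  bottomLabel-≤ : ∀ r c → suc (r + c) ≤ n → bottomLabel r c ≤ n
  bottomLabel-≤ r c = actWord-≤ (below r) (band-< r (n ∸ r))

  OnPipes : ℕ → ℕ → ℕ × ℕ → Set
  OnPipes p q b = b ∈ proj₁ (pipe n D p) × b ∈ proj₁ (pipe n D q)

  meetAt-on-pipes : ∀ {r c p q} → D (suc r) (suc c) ≡ true → MeetAt (suc r) c p q → OnPipes p q (suc r , suc c)
  meetAt-on-pipes {r} {c} e m = on-pipes m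
    where
    c<n : c < n
    c<n = ≤-trans (m≤n+m (suc c) (suc r)) (cross-bound e)
    left≤ : leftLabel (suc r) c ≤ n
    left≤ = leftLabel-≤ (suc r) c (≤-trans (+-monoʳ-≤ (suc r) (n≤1+n c)) (cross-bound e))
    bottom≤ : bottomLabel (suc r) c ≤ n
    bottom≤ = bottomLabel-≤ (suc r) c (subst (_≤ n) (+-suc (suc r) c) (cross-bound e))
    on-pipes : MeetAt (suc r) c _ _ → _
    on-pipes (inj₁ (refl , refl)) = label-on-pipe r c fromLeft refl c<n left≤ , label-on-pipe r c fromBottom refl c<n bottom≤
    on-pipes (inj₂ (refl , refl)) = label-on-pipe r c fromBottom refl c<n bottom≤ , label-on-pipe r c fromLeft refl c<n left≤

  crossed-twice : ∀ {p q b₁ b₂} → b₁ ≢ b₂ →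
    D (proj₁ b₁) (proj₂ b₁) ≡ true → OnPipes p q b₁ → D (proj₁ b₂) (proj₂ b₂) ≡ true → OnPipes p q b₂ →
    2 ≤ crossings n D p q
  crossed-twice {q = q} b₁≢b₂ e₁ (p₁ , q₁) e₂ (p₂ , q₂) = countB-≥2 _ p₁ p₂ b₁≢b₂ (crossed e₁ q₁) (crossed e₂ q₂)
    where
    crossed : ∀ {b} → D (proj₁ b) (proj₂ b) ≡ true → b ∈ proj₁ (pipe n D q) →
              (D (proj₁ b) (proj₂ b) ∧ anyB (boxEq b) (proj₁ (pipe n D q))) ≡ true
    crossed {b} e b∈ rewrite e = anyB-∈ (boxEq b) b∈ (boxEq-refl b)

  -- In a reduced pipe dream the pipe entering a cross from the left has the smaller label:
  -- otherwise the two pipes already crossed at an earlier box.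
  cross-ascent : IsReduced n D → ∀ r c → D (suc r) (suc c) ≡ true → leftLabel (suc r) c < bottomLabel (suc r) c
  cross-ascent red r c e with <-cmp (leftLabel (suc r) c) (bottomLabel (suc r) c)
  ... | tri< lt _ _ = lt
  ... | tri≈ _ eq _ = ⊥-elim (1+n≢n (sym (actWord-injective (rowWord D (suc r) 0 c)
                        (actWord-injective (below (suc r)) (trans eq (sym (prefixAct-bottom (suc r) c)))))))
  ... | tri> _ _ gt with inversionsCrossed (suc r) c (≤-trans (s≤s (m≤m+n r (suc c))) (cross-bound e))
                           (n<1+n (suc r + c)) (subst (_< leftLabel (suc r) c) (sym (prefixAct-bottom (suc r) c)) gt)
  ...   | zero , c′ , e′ , _ = contradiction (trans (sym e′) (no-cross-row₀ (suc c′))) λ ()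
  ...   | suc r′ , c′ , e′ , before , m′ =
    ⊥-elim (<⇒≱ (crossed-twice distinct e (meetAt-on-pipes e (inj₂ (refl , refl))) e′ (meetAt-on-pipes e′ m″))
                (red p q 1≤p gt q≤n))
    where
    p : ℕ
    p = bottomLabel (suc r) c
    q : ℕ
    q = leftLabel (suc r) c
    m″ : MeetAt (suc r′) c′ p q
    m″ = subst₂ (MeetAt (suc r′) c′) (prefixAct-bottom (suc r) c) refl m′
    1≤p : 1 ≤ p
    1≤p = ≤-trans (s≤s z≤n) (bottomLabel-> r c)
    q≤n : q ≤ n
    q≤n = leftLabel-≤ (suc r) c (≤-trans (+-monoʳ-≤ (suc r) (n≤1+n c)) (cross-bound e))
    distinct : (suc r , suc c) ≢ (suc r′ , suc c′)
    distinct refl = [ <-irrefl refl , <-irrefl refl ∘ proj₂ ]′ before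

  module _ (red : IsReduced n D) where

    length-snoc : ∀ (xs ys : List ℕ) z → length (xs ++ ys ++ z ∷ []) ≡ suc (length (xs ++ ys))
    length-snoc xs ys z = begin
      length (xs ++ ys ++ z ∷ [])   ≡⟨ cong length (++-assoc xs ys (z ∷ [])) ⟨
      length ((xs ++ ys) ++ z ∷ []) ≡⟨ length-++ (xs ++ ys) ⟩
      length (xs ++ ys) + 1         ≡⟨ +-comm _ 1 ⟩
      suc (length (xs ++ ys))       ∎

    inversions-row : ∀ r → inversions n (prefixAct (suc r) 0) ≡ length (below (suc r)) →
                     ∀ c → inversions n (prefixAct (suc r) c) ≡ length (below (suc r) ++ rowWord D (suc r) 0 c)
    inversions-row r base zero = trans base (cong length (sym (++-identityʳ (below (suc r)))))
    inversions-row r base (suc c) with D (suc r) (suc c) in e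
    ... | true = begin
      inversions n (prefixAct (suc r) (suc c))
        ≡⟨ inversions-cong n (λ y → prefixAct-cross (suc r) c y e) ⟩
      inversions n (prefixAct (suc r) c ∘ sᵢ (suc r + c))
        ≡⟨ inversions-∘sᵢ n (prefixAct (suc r) c) (suc r + c) (s≤s z≤n) (subst (_≤ n) (+-suc (suc r) c) (cross-bound e)) ascent ⟩
      suc (inversions n (prefixAct (suc r) c))
        ≡⟨ cong suc (inversions-row r base c) ⟩
      suc (length (below (suc r) ++ rowWord D (suc r) 0 c))
        ≡⟨ length-snoc (below (suc r)) _ _ ⟨
      length (below (suc r) ++ rowWord D (suc r) 0 c ++ (suc r + c) ∷ [])
        ≡⟨ cong (λ l → length (below (suc r) ++ l)) (rowWord-snoc-cross D (suc r) c e) ⟨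
      length (below (suc r) ++ rowWord D (suc r) 0 (suc c)) ∎
      where
      ascent : prefixAct (suc r) c (suc r + c) < prefixAct (suc r) c (suc (suc r + c))
      ascent = subst (leftLabel (suc r) c <_) (sym (prefixAct-bottom (suc r) c)) (cross-ascent red r c e)
    ... | false = begin
      inversions n (prefixAct (suc r) (suc c))
        ≡⟨ inversions-cong n (λ y → prefixAct-elbow (suc r) c y e) ⟩
      inversions n (prefixAct (suc r) c)
        ≡⟨ inversions-row r base c ⟩
      length (below (suc r) ++ rowWord D (suc r) 0 c)
        ≡⟨ cong (λ l → length (below (suc r) ++ l)) (rowWord-snoc-elbow D (suc r) c e) ⟨
      length (below (suc r) ++ rowWord D (suc r) 0 (suc c)) ∎

    inversions-below : ∀ d r → r + d ≡ n → inversions n (actWord (below r)) ≡ length (below r)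
    inversions-below zero r r+0≡n rewrite trans (sym (+-identityʳ r)) r+0≡n | n∸n≡0 n = inversions-id n
    inversions-below (suc d) r r+d≡n = begin
      inversions n (actWord (below r))
        ≡⟨ inversions-cong n (prefixAct-row r) ⟩
      inversions n (prefixAct (suc r) n)
        ≡⟨ inversions-row r (inversions-below d (suc r) (trans (sym (+-suc r d)) r+d≡n)) n ⟩
      length (below (suc r) ++ row (suc r))
        ≡⟨ cong length (below-suc r) ⟨
      length (below r) ∎

    inversions-word : inversions n (actWord (below 0)) ≡ length (below 0)
    inversions-word = inversions-below n 0 refl

module ReducedPipeDream (n : ℕ) (w : Permutation′ n) (D : Grid) (rp : InRP n w D) where
  open PipeWord n D (proj₁ (proj₁ rp))
  open PipePaths n D (proj₁ (proj₁ rp))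

  -- the pipe entering row w⁻¹(x) exits at column x
  below₀-acts : ∀ x → actWord (below 0) (suc (toℕ x)) ≡ suc (toℕ (flip w ⟨$⟩ʳ x))
  below₀-acts x = trans (cong (λ z → actWord (below 0) (suc (toℕ z))) (sym (inverseʳ w)))
                        (pipeExit-label (toℕ (w ⟨$⟩ˡ x)) (proj₂ (proj₁ rp) (w ⟨$⟩ˡ x)))

  below₀-length : length (below 0) ≡ invCount (flip w)
  below₀-length = sym (trans (invCount≡inversions n (flip w) (actWord (below 0)) below₀-acts) (inversions-word (proj₂ rp)))

-- Pairing

data TakeFirst (p : ℕ → Bool) (avail : List ℕ) : Maybe (List ℕ) → Set where
  taken : ∀ pre b post → avail ≡ pre ++ b ∷ post → p b ≡ true → All (λ z → p z ≡ false) pre →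
          TakeFirst p avail (just (pre ++ post))
  none  : All (λ z → p z ≡ false) avail → TakeFirst p avail nothing

takeFirst-view : ∀ p avail → TakeFirst p avail (takeFirst p avail)
takeFirst-view p [] = none []
takeFirst-view p (b ∷ bs) with p b in e
... | true  = taken [] b bs refl e []
... | false with takeFirst p bs | takeFirst-view p bs
...   | nothing | none all-false = none (e ∷ all-false)
...   | just _  | taken pre b′ post refl e′ pre-false = taken (b ∷ pre) b′ post refl e′ (e ∷ pre-false)

pairs : ℕ → ℕ → Bool
pairs j c = j ≤ᵇ c

unpaired-⊆ : ∀ xs avail {z} → z ∈ unpaired pairs xs avail → z ∈ xs
unpaired-⊆ (x ∷ xs) avail z∈ with takeFirst (pairs x) avail
... | just avail′ = there (unpaired-⊆ xs avail′ z∈)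
unpaired-⊆ (x ∷ xs) avail (here z≡) | nothing = here z≡
unpaired-⊆ (x ∷ xs) avail (there z∈) | nothing = there (unpaired-⊆ xs avail z∈)

common-paired : ∀ xs avail {x} → AllPairs _>_ xs → x ∈ xs → x ∈ avail → x ∉ unpaired pairs xs avail
common-paired (y ∷ ys) avail {x} (y> ∷ sorted) x∈xs x∈avail x∈unp
  with takeFirst (pairs y) avail | takeFirst-view (pairs y) avail
... | just _ | taken pre b post refl y≤b _ with x∈xs
...   | here refl  = <-irrefl refl (All.lookup y> (unpaired-⊆ ys (pre ++ post) x∈unp))
...   | there x∈ys = common-paired ys (pre ++ post) sorted x∈ys
                       (∈-remove pre post x∈avail (λ { refl → <⇒≱ (All.lookup y> x∈ys) (≤ᵇ-≤⁻ y≤b) })) x∈unp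
common-paired (y ∷ ys) avail (y> ∷ sorted) (here refl) x∈avail _ | nothing | none none-pair =
  ⊥-elim (<-irrefl refl (≤ᵇ->⁻ {y} {y} (All.lookup none-pair x∈avail)))
common-paired (y ∷ ys) avail (y> ∷ sorted) (there x∈ys) x∈avail (here refl) | nothing | none _ =
  <-irrefl refl (All.lookup y> x∈ys)
common-paired (y ∷ ys) avail (y> ∷ sorted) (there x∈ys) x∈avail (there x∈unp) | nothing | none _ =
  common-paired ys avail sorted x∈ys x∈avail x∈unp

_Covers[_,_⟩ : List ℕ → ℕ → ℕ → Set
xs Covers[ c , K ⟩ = ∀ z → c ≤ z → z < K → z ∈ xs

covers-tail : ∀ {y ys c K} → (y ∷ ys) Covers[ c , K ⟩ → K ≤ y → ys Covers[ c , K ⟩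
covers-tail covers K≤y z c≤z z<K with covers z c≤z z<K
... | here refl = ⊥-elim (<⇒≱ z<K K≤y)
... | there z∈  = z∈

covers-shrink : ∀ {xs c K} → xs Covers[ c , suc K ⟩ → xs Covers[ c , K ⟩
covers-shrink covers z c≤z z<K = covers z c≤z (m<n⇒m<1+n z<K)

covered-max : ∀ {y ys k} → AllPairs _>_ (y ∷ ys) → All (_< suc k) (y ∷ ys) → k ∈ y ∷ ys → y ≡ k
covered-max _ _ (here k≡y) = sym k≡y
covered-max (y> ∷ _) (y≤k ∷ _) (there k∈ys) = ⊥-elim (<⇒≱ (All.lookup y> k∈ys) (≤-pred y≤k))

-- Pigeonhole: if everything lies below K and all of [c, K) gets paired, then each
-- x ∈ [c, K) is paired within [x, K), which forces c ∈ avail.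
paired-interval-available : ∀ xs avail {c K} → AllPairs _<_ avail → All (_< K) avail →
  AllPairs _>_ xs → All (_< K) xs → xs Covers[ c , K ⟩ →
  (∀ z → c ≤ z → z < K → z ∉ unpaired pairs xs avail) → c < K → c ∈ avail
paired-interval-available [] avail _ _ _ _ covers _ c<K with () ← covers _ ≤-refl c<K
paired-interval-available (y ∷ ys) avail {c} {suc k} avail-sorted avail<K xs-sorted@(y> ∷ ys-sorted) xs<K
                          covers all-paired (s≤s c≤k)
  with covered-max xs-sorted xs<K (covers k c≤k ≤-refl) | takeFirst (pairs y) avail | takeFirst-view (pairs y) avail
... | y≡k | nothing | none _ = ⊥-elim (all-paired k c≤k ≤-refl (here (sym y≡k)))
... | y≡k | just _  | taken pre b post refl y≤b pre-unpaired = result (m≤n⇒m<n∨m≡n c≤k)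
  where
  b≡k : b ≡ k
  b≡k = ≤-antisym (≤-pred (All.lookup avail<K (∈-++⁺ʳ pre (here refl)))) (subst (_≤ b) y≡k (≤ᵇ-≤⁻ y≤b))
  rest<k : All (_< k) (pre ++ post)
  rest<k = All.++⁺ (All.map (λ p → subst (_ <_) y≡k (≤ᵇ->⁻ p)) pre-unpaired)
                   (All.map (λ {z} p → ⊥-elim (<⇒≱ (subst (_< z) b≡k (proj₁ p)) (≤-pred (proj₂ p))))
                     (All.zip (AllPairs-after pre post avail-sorted , All.tail (All.++⁻ʳ pre avail<K))))
  covers-ys : ys Covers[ c , k ⟩
  covers-ys = covers-tail (covers-shrink covers) (≤-reflexive (sym y≡k))
  result : c < k ⊎ c ≡ k → c ∈ pre ++ b ∷ post
  result (inj₂ refl) = ∈-++⁺ʳ pre (here (sym b≡k))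
  result (inj₁ c<k)  = ∈-unremove pre post
    (paired-interval-available ys (pre ++ post) (AllPairs-remove pre post avail-sorted) rest<k ys-sorted
      (subst (λ z → All (_< z) ys) y≡k y>) covers-ys (λ z c≤z z<k → all-paired z c≤z (m<n⇒m<1+n z<k)) c<k)

-- If j stays unpaired while all of [c, j) gets paired, the letters of [c, j) must have
-- been paired inside [c, j), so c is available.
unpaired-available-below : ∀ xs avail {j c} → AllPairs _<_ avail → AllPairs _>_ xs →
  j ∈ unpaired pairs xs avail → c < j → xs Covers[ c , suc j ⟩ →
  (∀ z → c ≤ z → z < j → z ∉ unpaired pairs xs avail) → c ∈ avail
unpaired-available-below (y ∷ ys) avail {j} avail-sorted (y> ∷ ys-sorted) j∈unp c<j covers all-paired
  with takeFirst (pairs y) avail | takeFirst-view (pairs y) avail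
... | just _ | taken pre b post refl _ _ = ∈-unremove pre post
  (unpaired-available-below ys (pre ++ post) (AllPairs-remove pre post avail-sorted) ys-sorted j∈unp c<j
    (covers-tail covers (All.lookup y> (unpaired-⊆ ys (pre ++ post) j∈unp))) all-paired)
... | nothing | none none-pair with j∈unp
...   | here refl = paired-interval-available ys avail avail-sorted (All.map ≤ᵇ->⁻ none-pair) ys-sorted y>
                      (covers-tail (covers-shrink covers) ≤-refl) (λ z c≤z z<j → all-paired z c≤z z<j ∘ there) c<j
...   | there j∈unp′ = unpaired-available-below ys avail avail-sorted ys-sorted j∈unp′ c<j
                         (covers-tail covers (All.lookup y> (unpaired-⊆ ys avail j∈unp′)))
                         (λ z c≤z z<j → all-paired z c≤z z<j ∘ there)

takeFirst-map : ∀ {p q : ℕ → Bool} (g : ℕ → ℕ) → (∀ y → q (g y) ≡ p y) →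
                ∀ ys → takeFirst q (map g ys) ≡ Maybe.map (map g) (takeFirst p ys)
takeFirst-map g q∘g≗p [] = refl
takeFirst-map {p} {q} g q∘g≗p (b ∷ bs) rewrite q∘g≗p b with p b
... | true  = refl
... | false rewrite takeFirst-map {p} {q} g q∘g≗p bs with takeFirst p bs
...   | nothing = refl
...   | just _  = refl

unpaired-map : ∀ {R S : ℕ → ℕ → Bool} (f g : ℕ → ℕ) → (∀ x y → S (f x) (g y) ≡ R x y) →
               ∀ xs ys → unpaired S (map f xs) (map g ys) ≡ map f (unpaired R xs ys)
unpaired-map f g S≗R [] ys = refl
unpaired-map {R} {S} f g S≗R (x ∷ xs) ys rewrite takeFirst-map {R x} {S (f x)} g (S≗R x) ys with takeFirst (R x) ys
... | just ys′ = unpaired-map f g S≗R xs ys′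
... | nothing  = cong (f x ∷_) (unpaired-map f g S≗R xs ys)

pairs-letters : ∀ i₀ j c → (letter (suc i₀) j <ᵇ letter (2 + i₀) c) ≡ pairs j c
pairs-letters i₀ zero    c = <ᵇ-< (s≤s (≤-trans (≤-reflexive (+-identityʳ i₀)) (m≤m+n i₀ c)))
pairs-letters i₀ (suc j) c with j <? c
... | yes j<c = trans (<ᵇ-< (s≤s (+-monoʳ-≤ i₀ j<c))) (sym (≤ᵇ-≤ j<c))
... | no  j≮c = trans (<ᵇ-≥ (subst (suc (i₀ + c) ≤_) (sym (+-suc i₀ j)) (s≤s (+-monoʳ-≤ i₀ (≮⇒≥ j≮c)))))
                      (sym (≤ᵇ-> (s≤s (≮⇒≥ j≮c))))

minL-unpairedRF-phi : ∀ n D i₀ →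
  minL (unpairedRF (phi n D) (suc i₀)) ≡ Maybe.map (letter (suc i₀)) (minL (unpairedPD n D (suc i₀)))
minL-unpairedRF-phi n D i₀ = begin
  minL (unpaired _<ᵇ_ (reverse (map (letter i) (crossCols n D i))) (phi n D (suc i)))
    ≡⟨ cong (λ l → minL (unpaired _<ᵇ_ l (phi n D (suc i)))) (reverse-map (letter i) (crossCols n D i)) ⟨
  minL (unpaired _<ᵇ_ (map (letter i) (reverse (crossCols n D i))) (map (letter (suc i)) (crossCols n D (suc i))))
    ≡⟨ cong minL (unpaired-map (letter i) (letter (suc i)) (pairs-letters i₀) (reverse (crossCols n D i)) _) ⟩
  minL (map (letter i) (unpairedPD n D i))
    ≡⟨ minL-map (letter i) (λ j≤j′ → ∸-monoˡ-≤ 1 (+-monoʳ-≤ i j≤j′)) (unpairedPD n D i) ⟩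
  Maybe.map (letter i) (minL (unpairedPD n D i)) ∎
  where
  i : ℕ
  i = suc i₀

moveLetter-at : ∀ r i u → moveLetter r i u i ≡ removeOne u (r i)
moveLetter-at r i u = if-true (≡ᵇ-refl i)

moveLetter-at-suc : ∀ r i u → moveLetter r i u (suc i) ≡ insertSorted (tOf (r i) u) (r (suc i))
moveLetter-at-suc r i u = trans (if-false (≡ᵇ-≢ (1+n≢n {i}))) (if-true (≡ᵇ-refl i))

moveLetter-elsewhere : ∀ r i u k → k ≢ i → k ≢ suc i → moveLetter r i u k ≡ r k
moveLetter-elsewhere r i u k k≢i k≢1+i = trans (if-false (≡ᵇ-≢ k≢i)) (if-false (≡ᵇ-≢ k≢1+i))

InRFC-cong : ∀ n v {r r′ : Fact} → (∀ k → r k ≡ r′ k) → InRFC n v r′ → InRFC n v r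
InRFC-cong n v r≗r′ (empty , blocks , reduced) =
  (λ k k∉ → trans (r≗r′ k) (empty k k∉)) ,
  (λ k 1≤k k<n → subst (λ l → Linked _<_ l × HeadGeq k l) (sym (r≗r′ k)) (blocks k 1≤k k<n)) ,
  subst (IsReducedWord n v) (sym (cong concat (map-cong r≗r′ (map suc (downFrom (n ∸ 1)))))) reduced

removeOne-++ : ∀ u xs ys → All (u ≢_) xs → removeOne u (xs ++ ys) ≡ xs ++ removeOne u ys
removeOne-++ u []       ys []       = refl
removeOne-++ u (x ∷ xs) ys (p ∷ ps) rewrite ≡ᵇ-≢ p = cong (x ∷_) (removeOne-++ u xs ys ps)

removeOne-head : ∀ u xs → removeOne u (u ∷ xs) ≡ xs
removeOne-head u xs rewrite ≡ᵇ-refl u = refl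

insertSorted-++ : ∀ t xs ys → All (_< t) xs → insertSorted t (xs ++ ys) ≡ xs ++ insertSorted t ys
insertSorted-++ t []       ys []       = refl
insertSorted-++ t (x ∷ xs) ys (p ∷ ps) rewrite ≤ᵇ-> p = cong (x ∷_) (insertSorted-++ t xs ys ps)

insertSorted-head : ∀ t xs → All (t <_) xs → insertSorted t xs ≡ t ∷ xs
insertSorted-head t []       []      = refl
insertSorted-head t (x ∷ xs) (p ∷ _) rewrite ≤ᵇ-≤ (<⇒≤ p) = refl

memℕ-phi-cross : ∀ n G i₀ z → G (suc i₀) (suc z) ≡ true → suc z ≤ n → memℕ (i₀ + suc z) (phi n G (suc i₀)) ≡ true
memℕ-phi-cross n G i₀ z e z<n = memℕ-∈ (∈-map⁺ (letter (suc i₀)) (crossCols-∈⁺ n G (suc i₀) e (s≤s z≤n) z<n))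

memℕ-phi-elbow : ∀ n G i₀ z → G (suc i₀) z ≡ false → memℕ (i₀ + z) (phi n G (suc i₀)) ≡ false
memℕ-phi-elbow n G i₀ z e = memℕ-∉ (subst (All (i₀ + z ≢_)) (sym (phi≡rowWord n G (suc i₀)))
  (All.map other-column (rowWord-crosses G (suc i₀) 0 n)))
  where
  other-column : ∀ {x} → Σ ℕ (λ j → G (suc i₀) j ≡ true × 0 < j × j ≤ n × x ≡ letter (suc i₀) j) → i₀ + z ≢ x
  other-column (suc j , e′ , _ , _ , refl) i₀+z≡ with refl ← +-cancelˡ-≡ i₀ z (suc j) i₀+z≡ =
    contradiction (trans (sym e′) e) λ ()

tOf-phi-run : ∀ n G i₀ c m → c ≤ m → m ≤ n → (∀ z → c < z → z ≤ m → G (suc i₀) z ≡ true) →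
              G (suc i₀) c ≡ false → tOf (phi n G (suc i₀)) (suc (i₀ + m)) ≡ suc (i₀ + c)
tOf-phi-run n G i₀ c m c≤m m≤n crosses elbow with m≤n⇒m<n∨m≡n c≤m
... | inj₂ refl rewrite memℕ-phi-elbow n G i₀ c elbow = refl
tOf-phi-run n G i₀ c (suc m) _ m<n crosses elbow | inj₁ (s≤s c≤m)
  rewrite memℕ-phi-cross n G i₀ m (crosses (suc m) (s≤s c≤m) ≤-refl) m<n =
  trans (cong (tOf (phi n G (suc i₀))) (+-suc i₀ m))
        (tOf-phi-run n G i₀ c m c≤m (<⇒≤ m<n) (λ z c<z z≤m → crosses z c<z (m≤n⇒m≤1+n z≤m)) elbow)

-- Chute moves

-- the configuration in which f_i moves the cross (i, j) to (i + 1, c₀)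
record Chute (D : Grid) (i c₀ j : ℕ) : Set where
  field
    c₀<j            : c₀ < j
    elbow           : D i c₀ ≡ false
    crosses         : ∀ z → c₀ < z → z ≤ j → D i z ≡ true
    elbow-below     : D (suc i) c₀ ≡ false
    crosses-below   : ∀ z → c₀ < z → z < j → D (suc i) z ≡ true
    elbow-below-end : D (suc i) j ≡ false

module ChuteMove (n : ℕ) (D : Grid) (pd : IsPipeDream n D) (i₀ c₀′ j′ : ℕ)
                 (chute : Chute D (suc i₀) (suc c₀′) (suc j′)) where
  open Chute chute

  i : ℕ
  i = suc i₀
  j : ℕ
  j = suc j′
  c₀ : ℕ
  c₀ = suc c₀′

  moved : Grid
  moved r c = if (r ≡ᵇ i) ∧ (c ≡ᵇ j) then false else (if (r ≡ᵇ suc i) ∧ (c ≡ᵇ c₀) then true else D r c)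

  moved-old : moved i j ≡ false
  moved-old rewrite ≡ᵇ-refl i | ≡ᵇ-refl j = refl

  moved-new : moved (suc i) c₀ ≡ true
  moved-new rewrite ≡ᵇ-≢ (1+n≢n {i}) | ≡ᵇ-refl i | ≡ᵇ-refl c₀ = refl

  moved-elsewhere : ∀ r c → r ≢ i → r ≢ suc i → moved r c ≡ D r c
  moved-elsewhere r c r≢i r≢1+i rewrite ≡ᵇ-≢ r≢i | ≡ᵇ-≢ r≢1+i = refl

  moved-row : ∀ c → c ≢ j → moved i c ≡ D i c
  moved-row c c≢j rewrite ≡ᵇ-refl i | ≡ᵇ-≢ c≢j | ≡ᵇ-≢ (1+n≢n {i} ∘ sym) = refl

  moved-row-below : ∀ c → c ≢ c₀ → moved (suc i) c ≡ D (suc i) c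
  moved-row-below c c≢c₀ rewrite ≡ᵇ-≢ (1+n≢n {i}) | ≡ᵇ-refl i | ≡ᵇ-≢ c≢c₀ = refl

  i+j≤n : i + j ≤ n
  i+j≤n = proj₂ (proj₂ (pd i j (crosses j c₀<j ≤-refl)))

  moved-pd : IsPipeDream n moved
  moved-pd r c e with r ≟ i | r ≟ suc i
  ... | yes refl | _ with c ≟ j
  ...   | yes refl = contradiction (trans (sym e) moved-old) λ ()
  ...   | no c≢j   = pd r c (trans (sym (moved-row c c≢j)) e)
  moved-pd r c e | no r≢i | yes refl with c ≟ c₀
  ...   | yes refl = s≤s z≤n , s≤s z≤n , ≤-trans (≤-reflexive (sym (+-suc i c₀))) (≤-trans (+-monoʳ-≤ i c₀<j) i+j≤n)
  ...   | no c≢c₀  = pd r c (trans (sym (moved-row-below c c≢c₀)) e)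
  moved-pd r c e | no r≢i | no r≢1+i = pd r c (trans (sym (moved-elsewhere r c r≢i r≢1+i)) e)

  run : Σ ℕ λ m → c₀ + m ≡ j′
  run = m≤n⇒∃[o]m+o≡n (≤-pred c₀<j)

  m : ℕ
  m = proj₁ run
  k : ℕ
  k = proj₁ (m≤n⇒∃[o]m+o≡n (≤-trans (m≤n+m j i) i+j≤n))

  row-segments : ∀ G r → rowWord G r 0 n
    ≡ rowWord G r 0 c₀′ ++ rowWord G r c₀′ 1 ++ rowWord G r c₀ m ++ rowWord G r j′ 1 ++ rowWord G r j k
  row-segments G r = begin
    rowWord G r 0 n
      ≡⟨ cong (rowWord G r 0) (sym n≡) ⟩
    rowWord G r 0 (c₀′ + (1 + (m + (1 + k))))
      ≡⟨ rowWord-++ G r 0 c₀′ (1 + (m + (1 + k))) ⟩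
    rowWord G r 0 c₀′ ++ rowWord G r c₀′ (1 + (m + (1 + k)))
      ≡⟨ cong (rowWord G r 0 c₀′ ++_) (rowWord-++ G r c₀′ 1 (m + (1 + k))) ⟩
    rowWord G r 0 c₀′ ++ rowWord G r c₀′ 1 ++ rowWord G r (c₀′ + 1) (m + (1 + k))
      ≡⟨ cong (λ a → rowWord G r 0 c₀′ ++ rowWord G r c₀′ 1 ++ rowWord G r a (m + (1 + k))) (+-comm c₀′ 1) ⟩
    rowWord G r 0 c₀′ ++ rowWord G r c₀′ 1 ++ rowWord G r c₀ (m + (1 + k))
      ≡⟨ cong (λ l → rowWord G r 0 c₀′ ++ rowWord G r c₀′ 1 ++ l) (rowWord-++ G r c₀ m (1 + k)) ⟩
    rowWord G r 0 c₀′ ++ rowWord G r c₀′ 1 ++ rowWord G r c₀ m ++ rowWord G r (c₀ + m) (1 + k)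
      ≡⟨ cong (λ a → rowWord G r 0 c₀′ ++ rowWord G r c₀′ 1 ++ rowWord G r c₀ m ++ rowWord G r a (1 + k)) (proj₂ run) ⟩
    rowWord G r 0 c₀′ ++ rowWord G r c₀′ 1 ++ rowWord G r c₀ m ++ rowWord G r j′ (1 + k)
      ≡⟨ cong (λ l → rowWord G r 0 c₀′ ++ rowWord G r c₀′ 1 ++ rowWord G r c₀ m ++ l)
              (trans (rowWord-++ G r j′ 1 k) (cong (λ a → rowWord G r j′ 1 ++ rowWord G r a k) (+-comm j′ 1))) ⟩
    rowWord G r 0 c₀′ ++ rowWord G r c₀′ 1 ++ rowWord G r c₀ m ++ rowWord G r j′ 1 ++ rowWord G r j k ∎
    where
    n≡ : c₀′ + (1 + (m + (1 + k))) ≡ n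
    n≡ = begin
      c₀′ + (1 + (m + (1 + k))) ≡⟨ +-suc c₀′ (m + suc k) ⟩
      suc (c₀′ + (m + suc k))   ≡⟨ cong suc (+-assoc c₀′ m (suc k)) ⟨
      suc (c₀′ + m + suc k)     ≡⟨ cong suc (+-suc (c₀′ + m) k) ⟩
      suc (suc (c₀′ + m + k))   ≡⟨ cong (λ x → suc (x + k)) (proj₂ run) ⟩
      j + k                     ≡⟨ proj₂ (m≤n⇒∃[o]m+o≡n (≤-trans (m≤n+m j i) i+j≤n)) ⟩
      n                         ∎

  -- t and U are the letters of the new cross (i+1, c₀) and the old cross (i, j); C, E and A, B
  -- are the words of rows i and i+1 to the left of c₀ and to the right of j.
  t : ℕ
  t = i + c₀
  U : ℕ
  U = t + m

  letter-moved : letter i j ≡ U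
  letter-moved = trans (letter-suc i j′) (trans (cong (i +_) (sym (proj₂ run))) (sym (+-assoc i c₀ m)))

  inside : ∀ {z} → z ≤ c₀ + m → z < j
  inside z≤ = s≤s (≤-trans z≤ (≤-reflexive (proj₂ run)))

  C : List ℕ
  C = rowWord D i 0 c₀′
  E : List ℕ
  E = rowWord D i j k
  A : List ℕ
  A = rowWord D (suc i) 0 c₀′
  B : List ℕ
  B = rowWord D (suc i) j k

  row-before : rowWord D i 0 n ≡ C ++ range t m ++ U ∷ E
  row-before = trans (row-segments D i) (cong (C ++_) (cong₂ _++_ (rowWord-elbow D i c₀′ elbow)
    (cong₂ _++_ (rowWord-full D i c₀ m (λ z c₀<z z≤ → crosses z c₀<z (<⇒≤ (inside z≤))))
      (cong (_++ E) (trans (rowWord-cross D i j′ (crosses j c₀<j ≤-refl))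
                           (cong (_∷ []) (trans (sym (letter-suc i j′)) letter-moved)))))))

  row-after : rowWord moved i 0 n ≡ C ++ range t m ++ E
  row-after = trans (row-segments moved i) (cong₂ _++_
    (rowWord-cong moved i {D} 0 c₀′ (λ z _ z≤ → moved-row z (<⇒≢ (≤-<-trans z≤ (<-trans (n<1+n c₀′) c₀<j)))))
    (cong₂ _++_ (rowWord-elbow moved i c₀′ (trans (moved-row c₀ (<⇒≢ c₀<j)) elbow))
      (cong₂ _++_ (rowWord-full moved i c₀ m
                     (λ z c₀<z z≤ → trans (moved-row z (<⇒≢ (inside z≤))) (crosses z c₀<z (<⇒≤ (inside z≤)))))
        (cong₂ _++_ (rowWord-elbow moved i j′ moved-old)
          (rowWord-cong moved i {D} j k (λ z j<z _ → moved-row z (>⇒≢ j<z)))))))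

  row-below-before : rowWord D (suc i) 0 n ≡ A ++ range (suc t) m ++ B
  row-below-before = trans (row-segments D (suc i)) (cong (A ++_) (cong₂ _++_ (rowWord-elbow D (suc i) c₀′ elbow-below)
    (cong₂ _++_ (rowWord-full D (suc i) c₀ m (λ z c₀<z z≤ → crosses-below z c₀<z (inside z≤)))
      (cong (_++ B) (rowWord-elbow D (suc i) j′ elbow-below-end)))))

  row-below-after : rowWord moved (suc i) 0 n ≡ A ++ t ∷ range (suc t) m ++ B
  row-below-after = trans (row-segments moved (suc i)) (cong₂ _++_
    (rowWord-cong moved (suc i) {D} 0 c₀′ (λ z _ z≤ → moved-row-below z (<⇒≢ (s≤s z≤))))
    (cong₂ _++_ (trans (rowWord-cross moved (suc i) c₀′ moved-new) (cong (_∷ []) (sym (+-suc i c₀′))))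
      (cong₂ _++_ (rowWord-full moved (suc i) c₀ m
                     (λ z c₀<z z≤ → trans (moved-row-below z (>⇒≢ c₀<z)) (crosses-below z c₀<z (inside z≤))))
        (cong₂ _++_ (rowWord-elbow moved (suc i) j′ (trans (moved-row-below j (>⇒≢ c₀<j)) elbow-below-end))
          (rowWord-cong moved (suc i) {D} j k (λ z j<z _ → moved-row-below z (>⇒≢ (<-trans c₀<j j<z))))))))

  C≪t : All (λ x → 2 + x ≤ t) C
  C≪t = All.map
    (λ {x} p → subst (2 + x ≤_) (sym (+-suc i c₀′)) (s≤s (subst (suc x ≤_) (cong (_+ c₀′) (+-identityʳ i)) (proj₂ p))))
                (rowWord-bounds D i 0 c₀′)

  A<t : All (_< t) A
  A<t = All.map (λ {x} p → subst (x <_) (trans (cong (_+ c₀′) (+-identityʳ (suc i))) (sym (+-suc i c₀′))) (proj₂ p))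
                (rowWord-bounds D (suc i) 0 c₀′)

  U≪B : All (2 + U ≤_) B
  U≪B = All.map
    (λ {x} p → subst (_≤ x) (trans (cong suc (+-suc i j′)) (cong (2 +_) (trans (sym (letter-suc i j′)) letter-moved))) (proj₁ p))
                (rowWord-bounds D (suc i) j k)

  remove-moved : removeOne (letter i j) (rowWord D i 0 n) ≡ rowWord moved i 0 n
  remove-moved = begin
    removeOne (letter i j) (rowWord D i 0 n)
      ≡⟨ cong₂ removeOne letter-moved row-before ⟩
    removeOne U (C ++ range t m ++ U ∷ E)
      ≡⟨ removeOne-++ U C _ (All.map (λ p → >⇒≢ (<-≤-trans (s≤s (n≤1+n _)) (≤-trans p (m≤m+n t m)))) C≪t) ⟩
    C ++ removeOne U (range t m ++ U ∷ E)
      ≡⟨ cong (C ++_) (removeOne-++ U (range t m) (U ∷ E) (All.map (>⇒≢ ∘ proj₂) (range-bounds t m))) ⟩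
    C ++ range t m ++ removeOne U (U ∷ E)
      ≡⟨ cong (λ l → C ++ range t m ++ l) (removeOne-head U E) ⟩
    C ++ range t m ++ E
      ≡⟨ row-after ⟨
    rowWord moved i 0 n ∎

  tOf-moved : tOf (phi n D i) (letter i j) ≡ t
  tOf-moved = trans (cong (tOf (phi n D i)) (letter-suc i j′))
    (tOf-phi-run n D i₀ c₀ j′ (≤-pred c₀<j) (≤-trans (n≤1+n j′) (≤-trans (m≤n+m j i) i+j≤n))
      (λ z c₀<z z≤ → crosses z c₀<z (m≤n⇒m≤1+n z≤)) elbow)

  insert-moved : insertSorted t (rowWord D (suc i) 0 n) ≡ rowWord moved (suc i) 0 n
  insert-moved = begin
    insertSorted t (rowWord D (suc i) 0 n)
      ≡⟨ cong (insertSorted t) row-below-before ⟩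
    insertSorted t (A ++ range (suc t) m ++ B)
      ≡⟨ insertSorted-++ t A _ A<t ⟩
    A ++ insertSorted t (range (suc t) m ++ B)
      ≡⟨ cong (A ++_) (insertSorted-head t _ (All.++⁺ (All.map proj₁ (range-bounds (suc t) m))
                                                     (All.map (<-≤-trans (s≤s (≤-trans (m≤m+n t m) (n≤1+n _)))) U≪B))) ⟩
    A ++ t ∷ range (suc t) m ++ B
      ≡⟨ row-below-after ⟨
    rowWord moved (suc i) 0 n ∎

  phi-moved : ∀ r → moveLetter (phi n D) i (letter i j) r ≡ phi n moved r
  phi-moved r with r ≟ i | r ≟ suc i
  ... | yes refl | _ = trans (moveLetter-at (phi n D) i _)
    (trans (cong (removeOne _) (phi≡rowWord n D i)) (trans remove-moved (sym (phi≡rowWord n moved i))))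
  ... | no _ | yes refl = trans (moveLetter-at-suc (phi n D) i _)
    (trans (cong₂ insertSorted tOf-moved (phi≡rowWord n D (suc i))) (trans insert-moved (sym (phi≡rowWord n moved (suc i)))))
  ... | no r≢i | no r≢1+i = trans (moveLetter-elsewhere (phi n D) i _ r r≢i r≢1+i)
    (trans (phi≡rowWord n D r)
      (trans (rowWord-cong D r {moved} 0 n (λ z _ _ → sym (moved-elsewhere r z r≢i r≢1+i))) (sym (phi≡rowWord n moved r))))

  module W  = PipeWord n D pd
  module W′ = PipeWord n moved moved-pd

  band-unmoved : ∀ r d → (∀ k → r < k → k ≤ r + d → k ≢ i × k ≢ suc i) → W′.band r d ≡ W.band r d
  band-unmoved r zero    _       = refl
  band-unmoved r (suc d) unmoved = cong₂ _++_
    (rowWord-cong moved (r + suc d) {D} 0 n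
      (λ z _ _ → uncurry (moved-elsewhere (r + suc d) z) (unmoved (r + suc d) r<r+1+d ≤-refl)))
    (band-unmoved r d (λ k r<k k≤ → unmoved k r<k (≤-trans k≤ (+-monoʳ-≤ r (n≤1+n d)))))
    where
    r<r+1+d : r < r + suc d
    r<r+1+d = subst (r <_) (sym (+-suc r d)) (s≤s (m≤m+n r d))

  X : List ℕ
  X = W.below (suc i)
  Y : List ℕ
  Y = W.band 0 i₀
  R₂ : List ℕ
  R₂ = A ++ range (suc t) m ++ B
  R₂′ : List ℕ
  R₂′ = A ++ t ∷ range (suc t) m ++ B
  R₁ : List ℕ
  R₁ = C ++ range t m ++ U ∷ E
  R₁′ : List ℕ
  R₁′ = C ++ range t m ++ E

  word-before : W.below 0 ≡ X ++ R₂ ++ R₁ ++ Y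
  word-before = trans (W.below₀-split (suc i)) (cong (X ++_) (cong₂ _++_ row-below-before (cong (_++ Y) row-before)))

  word-after : W′.below 0 ≡ X ++ R₂′ ++ R₁′ ++ Y
  word-after = trans (W′.below₀-split (suc i)) (cong₂ _++_
    (band-unmoved (suc i) (n ∸ suc i) (λ k i+1<k _ → >⇒≢ (<-trans (n<1+n i) i+1<k) , >⇒≢ i+1<k))
    (cong₂ _++_ row-below-after (cong₂ _++_ row-after
      (band-unmoved 0 i₀ (λ k _ k≤i₀ → <⇒≢ (s≤s k≤i₀) , <⇒≢ (m<n⇒m<1+n (s≤s k≤i₀)))))))

  length₄ : ∀ (P Q R S : List ℕ) → length (P ++ Q ++ R ++ S) ≡ length P + (length Q + (length R + length S))
  length₄ P Q R S = trans (length-++ P) (cong (length P +_) (trans (length-++ Q) (cong (length Q +_) (length-++ R))))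

  moved-length : length (W′.below 0) ≡ length (W.below 0)
  moved-length = begin
    length (W′.below 0)
      ≡⟨ trans (cong length word-after) (length₄ X R₂′ R₁′ Y) ⟩
    length X + (length R₂′ + (length R₁′ + length Y))
      ≡⟨ cong (λ a → length X + (a + (length R₁′ + length Y))) (length-++-sucʳ A t (range (suc t) m ++ B)) ⟩
    length X + suc (length R₂ + (length R₁′ + length Y))
      ≡⟨ cong (length X +_) (+-suc _ _) ⟨
    length X + (length R₂ + (suc (length R₁′) + length Y))
      ≡⟨ cong (λ a → length X + (length R₂ + (a + length Y))) (sym length-row) ⟩
    length X + (length R₂ + (length R₁ + length Y))
      ≡⟨ trans (cong length word-before) (length₄ X R₂ R₁ Y) ⟨
    length (W.below 0) ∎
    where
    length-row : length R₁ ≡ suc (length R₁′)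
    length-row = begin
      length R₁                            ≡⟨ cong length (++-assoc C (range t m) (U ∷ E)) ⟨
      length ((C ++ range t m) ++ U ∷ E)   ≡⟨ length-++-sucʳ (C ++ range t m) U E ⟩
      suc (length ((C ++ range t m) ++ E)) ≡⟨ cong (suc ∘ length) (++-assoc C (range t m) E) ⟩
      suc (length R₁′)                     ∎

  moved-act : ∀ y → actWord (W′.below 0) y ≡ actWord (W.below 0) y
  moved-act y = begin
    actWord (W′.below 0) y
      ≡⟨ cong (λ l → actWord l y) word-after ⟩
    actWord (X ++ R₂′ ++ R₁′ ++ Y) y
      ≡⟨ act₄ X R₂′ R₁′ Y ⟩
    actWord X (actWord R₂′ (actWord R₁′ (actWord Y y)))
      ≡⟨ cong (actWord X) (chute-word A B C E t m C≪t U≪B (actWord Y y)) ⟩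
    actWord X (actWord R₂ (actWord R₁ (actWord Y y)))
      ≡⟨ act₄ X R₂ R₁ Y ⟨
    actWord (X ++ R₂ ++ R₁ ++ Y) y
      ≡⟨ cong (λ l → actWord l y) word-before ⟨
    actWord (W.below 0) y ∎
    where
    act₄ : ∀ P Q R S → actWord (P ++ Q ++ R ++ S) y ≡ actWord P (actWord Q (actWord R (actWord S y)))
    act₄ P Q R S = trans (actWord-++ P _ y) (cong (actWord P) (trans (actWord-++ Q _ y) (cong (actWord Q) (actWord-++ R S y))))

module _ {n : ℕ} {D : Grid} (pd : IsPipeDream n D) where
  open PipeWord n D pd
  open PipePaths n D pd

  -- At the two crosses (i, j) and (i+1, c₀) the same two pipes would meet, entering in
  -- opposite directions, so one of them violates cross-ascent.
  no-cross-below-elbow : IsReduced n D → ∀ i₀ c₀′ j′ → suc c₀′ ≤ j′ →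
    D (suc i₀) (suc c₀′) ≡ false → (∀ z → suc c₀′ < z → z ≤ suc j′ → D (suc i₀) z ≡ true) →
    D (2 + i₀) (suc j′) ≡ false → (∀ z → suc c₀′ < z → z < suc j′ → D (2 + i₀) z ≡ true) →
    D (2 + i₀) (suc c₀′) ≢ true
  no-cross-below-elbow red i₀ c₀′ j′ c₀<j elbow crosses elbow-below-end crosses-below cross
    with m , c₀+m≡j′ ← m≤n⇒∃[o]m+o≡n c₀<j =
    <-asym (cross-ascent red (suc i₀) c₀′ cross)
           (subst₂ _<_ upper-left≡ upper-bottom≡ (cross-ascent red i₀ j′ (crosses (suc j′) (s≤s c₀<j) ≤-refl)))
    where
    i : ℕ
    i = suc i₀
    c₀ : ℕ
    c₀ = suc c₀′
    upper-left≡ : leftLabel i j′ ≡ bottomLabel (suc i) c₀′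
    upper-left≡ = begin
      leftLabel i j′          ≡⟨ cong (leftLabel i) c₀+m≡j′ ⟨
      leftLabel i (c₀ + m)
        ≡⟨ leftLabel-run i c₀ m (λ z c₀<z z≤ → crosses z c₀<z (≤-trans z≤ (≤-trans (≤-reflexive c₀+m≡j′) (n≤1+n j′)))) ⟩
      leftLabel i c₀          ≡⟨ leftLabel-elbow i c₀′ elbow ⟩
      bottomLabel i c₀′       ≡⟨ topLabel-suc i c₀′ ⟨
      topLabel (suc i) c₀′    ≡⟨ topLabel-cross (suc i) c₀′ cross ⟩
      bottomLabel (suc i) c₀′ ∎
      where open ≡-Reasoning
    upper-bottom≡ : bottomLabel i j′ ≡ leftLabel (suc i) c₀′
    upper-bottom≡ = begin
      bottomLabel i j′            ≡⟨ topLabel-suc i j′ ⟨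
      topLabel (suc i) j′         ≡⟨ topLabel-elbow (suc i) j′ elbow-below-end ⟩
      leftLabel (suc i) j′        ≡⟨ cong (leftLabel (suc i)) c₀+m≡j′ ⟨
      leftLabel (suc i) (c₀ + m)
        ≡⟨ leftLabel-run (suc i) c₀ m (λ z c₀<z z≤ → crosses-below z c₀<z (s≤s (≤-trans z≤ (≤-reflexive c₀+m≡j′)))) ⟩
      leftLabel (suc i) c₀        ≡⟨ leftLabel-cross (suc i) c₀′ cross ⟩
      leftLabel (suc i) c₀′       ∎
      where open ≡-Reasoning

  moveLetter-full-row : ∀ i₀ j′ → suc j′ ≤ n → (∀ k → 1 ≤ k → k ≤ suc j′ → D (suc i₀) k ≡ true) →
    moveLetter (phi n D) (suc i₀) (letter (suc i₀) (suc j′)) (2 + i₀) ≡ suc i₀ ∷ phi n D (2 + i₀)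
  moveLetter-full-row i₀ j′ j≤n full = trans (moveLetter-at-suc (phi n D) i _)
    (trans (cong (λ t → insertSorted t (phi n D (suc i))) t≡i)
      (insertSorted-head i _ (subst (All (i <_)) (sym (phi≡rowWord n D (suc i))) (row-≥ (suc i)))))
    where
    i : ℕ
    i = suc i₀
    t≡i : tOf (phi n D i) (letter i (suc j′)) ≡ i
    t≡i = trans (cong (tOf (phi n D i)) (letter-suc i j′))
      (trans (tOf-phi-run n D i₀ 0 j′ z≤n (≤-trans (n≤1+n j′) j≤n) (λ z 0<z z≤ → full z 0<z (m≤n⇒m≤1+n z≤)) (no-cross-column₀ i))
             (cong suc (+-identityʳ i₀)))

  full-row-blocks-move : ∀ {v} i₀ j′ → suc i₀ < n → suc j′ ≤ n →
    (∀ k → 1 ≤ k → k ≤ suc j′ → D (suc i₀) k ≡ true) →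
    ¬ InRFC n v (moveLetter (phi n D) (suc i₀) (letter (suc i₀) (suc j′)))
  full-row-blocks-move i₀ j′ i<n j≤n full (empty , blocks , _)
    with moveLetter-full-row i₀ j′ j≤n full | m≤n⇒m<n∨m≡n i<n
  ... | moved | inj₁ i+1<n = <-irrefl refl (subst (HeadGeq (2 + i₀)) moved (proj₂ (blocks (2 + i₀) (s≤s z≤n) i+1<n)))
  ... | moved | inj₂ i+1≡n with () ← trans (sym moved) (empty (2 + i₀) (inj₂ (≤-reflexive (sym i+1≡n))))

chute-InRFC : ∀ n w D → InRP n w D → ∀ i₀ c₀′ j′ → Chute D (suc i₀) (suc c₀′) (suc j′) →
              InRFC n (flip w) (moveLetter (phi n D) (suc i₀) (letter (suc i₀) (suc j′)))
chute-InRFC n w D rp i₀ c₀′ j′ chute =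
  InRFC-cong n (flip w) phi-moved
    (W′.InRFC-phi {flip w} (trans moved-length below₀-length) (λ x → trans (moved-act _) (below₀-acts x)))
  where
  open ChuteMove n D (proj₁ (proj₁ rp)) i₀ c₀′ j′ chute
  open ReducedPipeDream n w D rp

rightmost-elbow : ∀ (G : Grid) r m → (∀ k → 1 ≤ k → k ≤ m → G r k ≡ true) ⊎
  Σ ℕ λ c₀ → 1 ≤ c₀ × c₀ ≤ m × G r c₀ ≡ false × (∀ z → c₀ < z → z ≤ m → G r z ≡ true)
rightmost-elbow G r zero = inj₁ (λ k 1≤k k≤0 → ⊥-elim (<⇒≱ 1≤k k≤0))
rightmost-elbow G r (suc m) with G r (suc m) in e
... | false = inj₂ (suc m , s≤s z≤n , ≤-refl , e , λ z m<z z≤m → ⊥-elim (<⇒≱ m<z z≤m))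
... | true with rightmost-elbow G r m
...   | inj₁ full = inj₁ (λ k 1≤k k≤ → [ full k 1≤k ∘ ≤-pred , (λ { refl → e }) ]′ (m≤n⇒m<n∨m≡n k≤))
...   | inj₂ (c₀ , 1≤c₀ , c₀≤m , elbow , crosses) =
  inj₂ (c₀ , 1≤c₀ , m≤n⇒m≤1+n c₀≤m , elbow , λ z c₀<z z≤ → [ crosses z c₀<z ∘ ≤-pred , (λ { refl → e }) ]′ (m≤n⇒m<n∨m≡n z≤))

leftmost-unpaired-chute : ∀ {n D} → IsPipeDream n D → IsReduced n D → ∀ i₀ c₀′ j′ →
  minL (unpairedPD n D (suc i₀)) ≡ just (suc j′) → suc c₀′ < suc j′ → D (suc i₀) (suc c₀′) ≡ false →
  (∀ z → suc c₀′ < z → z ≤ suc j′ → D (suc i₀) z ≡ true) → Chute D (suc i₀) (suc c₀′) (suc j′)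
leftmost-unpaired-chute {n} {D} pd red i₀ c₀′ j′ min≡j c₀<j elbow crosses = record
  { c₀<j = c₀<j ; elbow = elbow ; crosses = crosses
  ; elbow-below = elbow-below ; crosses-below = crosses-below ; elbow-below-end = elbow-below-end }
  where
  i : ℕ
  i = suc i₀
  j : ℕ
  j = suc j′
  xs : List ℕ
  xs = reverse (crossCols n D i)
  avail : List ℕ
  avail = crossCols n D (suc i)
  j∈unpaired : j ∈ unpairedPD n D i
  j∈unpaired = proj₁ (minL-just _ min≡j)
  j-leftmost : All (j ≤_) (unpairedPD n D i)
  j-leftmost = proj₂ (minL-just _ min≡j)
  xs-sorted : AllPairs _>_ xs
  xs-sorted = AllPairs-reverse (crossCols-sorted n D i)
  j≤n : j ≤ n
  j≤n = proj₂ (proj₂ (crossCols-∈⁻ n D i (Any.reverse⁻ (unpaired-⊆ xs avail j∈unpaired))))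
  j∈xs : j ∈ xs
  j∈xs = Any.reverse⁺ (crossCols-∈⁺ n D i (crosses j c₀<j ≤-refl) (s≤s z≤n) j≤n)
  elbow-below-end : D (suc i) j ≡ false
  elbow-below-end with D (suc i) j in e
  ... | false = refl
  ... | true  = ⊥-elim (common-paired xs avail xs-sorted j∈xs (crossCols-∈⁺ n D (suc i) e (s≤s z≤n) j≤n) j∈unpaired)
  crosses-below : ∀ z → suc c₀′ < z → z < j → D (suc i) z ≡ true
  crosses-below z c₀<z z<j = proj₁ (crossCols-∈⁻ n D (suc i)
    (unpaired-available-below xs avail (crossCols-sorted n D (suc i)) xs-sorted j∈unpaired z<j covered
      (λ z′ _ z′<j z′∈ → <⇒≱ z′<j (All.lookup j-leftmost z′∈))))
    where
    covered : xs Covers[ z , suc j ⟩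
    covered z′ z≤z′ z′≤j = Any.reverse⁺ (crossCols-∈⁺ n D i (crosses z′ (<-≤-trans c₀<z z≤z′) (≤-pred z′≤j))
                                           (≤-trans (s≤s z≤n) (<-≤-trans c₀<z z≤z′)) (≤-trans (≤-pred z′≤j) j≤n))
  elbow-below : D (suc i) (suc c₀′) ≡ false
  elbow-below with D (suc i) (suc c₀′) in e
  ... | false = refl
  ... | true  =
    ⊥-elim (no-cross-below-elbow pd red i₀ c₀′ j′ (≤-pred c₀<j) elbow crosses elbow-below-end crosses-below e)

blocked-move-full-row : ∀ {n w D} → InRP n w D → ∀ i₀ j′ →
  minL (unpairedPD n D (suc i₀)) ≡ just (suc j′) → D (suc i₀) (suc j′) ≡ true →
  ¬ InRFC n (flip w) (moveLetter (phi n D) (suc i₀) (letter (suc i₀) (suc j′))) →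
  ∀ k → 1 ≤ k → k ≤ suc j′ → D (suc i₀) k ≡ true
blocked-move-full-row {n} {w} {D} rp i₀ j′ min≡j j-cross blocked with rightmost-elbow D (suc i₀) (suc j′)
... | inj₁ full = full
... | inj₂ (suc c₀′ , _ , c₀≤j , elbow , crosses) =
  ⊥-elim (blocked (chute-InRFC n w D rp i₀ c₀′ j′
    (leftmost-unpaired-chute (proj₁ (proj₁ rp)) (proj₂ rp) i₀ c₀′ j′ min≡j c₀<j elbow crosses)))
  where
  c₀<j : suc c₀′ < suc j′
  c₀<j = ≤∧≢⇒< c₀≤j (λ { refl → contradiction (trans (sym j-cross) elbow) λ () })

lemma5p5 : (n : ℕ) (w : Permutation′ n) (D : Grid) → InRP n w D →
    (i : ℕ) → 1 ≤ i → i < n →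
    PDfZero n D i ⇔ RFfZero n (flip w) (phi n D) i
lemma5p5 n w D rp (suc i₀) _ i<n =
  subst (zeroPDAt D i (minL (unpairedPD n D i)) ⇔_)
        (cong (zeroRFAt n (flip w) (phi n D) i) (sym (minL-unpairedRF-phi n D i₀)))
    (at-leftmost (minL (unpairedPD n D i)) refl)
  where
  i : ℕ
  i = suc i₀
  pd : IsPipeDream n D
  pd = proj₁ (proj₁ rp)
  at-leftmost : ∀ u → minL (unpairedPD n D i) ≡ u →
                zeroPDAt D i u ⇔ zeroRFAt n (flip w) (phi n D) i (Maybe.map (letter i) u)
  at-leftmost nothing  _ = mk⇔ _ _
  at-leftmost (just j) min≡j with crossCols-∈⁻ n D i (Any.reverse⁻ (unpaired-⊆ _ _ (proj₁ (minL-just _ min≡j))))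
  ... | j-cross , s≤s {n = j′} z≤n , j≤n =
    mk⇔ (full-row-blocks-move pd {flip w} i₀ j′ i<n j≤n) (blocked-move-full-row {w = w} rp i₀ j′ min≡j j-cross)
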